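{- For all integers $n,k\geq 0$, \begin{align*} c_{9,5}\left(2^{3k+5}n+\frac{27\cdot 2^{3k+3}+1}{7}\right)&\equiv 0\pmod 2,\\ c_{9,5}\left(2^{3k+6}n+\frac{3\cdot 2^{3k+4}+1}{7}\right)&\equiv 0\pmod 2,\\ c_{9,5}\left(2^{3k+7}n+\frac{19\cdot 2^{3k+5}+1}{7}\right)&\equiv 0\pmod 2. \end{align*}
   Context: For complex $a,b$ the false theta function is $\Psi(a,b):=\sum_{n=0}^\infty a^{n(n+1)/2}b^{n(n-1)/2}-\sum_{n=-\infty}^{ -1}a^{n(n+1)/2}b^{n(n-1)/2}$. For positive integers $r,s$, the integers $c_{r,s}(n)$ ($n\ge 0$) are defined by the power series identity $\sum_{n=0}^\infty c_{r,s}(n)q^n=\dfrac{1}{\Psi(-q^r,q^s)}$ (the denominator is a power series in $q$ with constant term $1$). -}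

module Defs where

open import Data.Nat as ℕ using (ℕ; zero; suc)
open import Data.Nat.DivMod as ℕD using ()
open import Data.Integer using (ℤ; +_; -[1+_]; _+_; _*_; -_; _^_)
open import Data.List using (List; []; _∷_; foldr; map; upTo; zipWith)
open import Relation.Nullary using (yes; no)

tri : ℕ → ℕ
tri n = (n ℕ.* suc n) ℕD./ 2

tri' : ℕ → ℕ
tri' n = (n ℕ.* (n ℕ.∸ 1)) ℕD./ 2

sumℤ : List ℤ → ℤ
sumℤ = foldr _+_ (+ 0)

select : ℕ → ℕ → ℤ → ℤ
select e N v with e ℕ.≟ N
... | yes _ = v
... | no  _ = + 0

-- Coefficient of q^N in Ψ(-q^r, q^s).
-- Term n ≥ 0 of Ψ(a,b): a^{n(n+1)/2} b^{n(n-1)/2}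
--   = (-1)^{tri n} q^{r·tri n + s·tri' n}.
-- Term n = -m (m ≥ 1): n(n+1)/2 = tri' m, n(n-1)/2 = tri m, with a minus sign:
--   - (-1)^{tri' m} q^{r·tri' m + s·tri m}.
-- Every exponent with n ≥ 1 (resp. m ≥ 1) is ≥ n (resp. m) when r,s ≥ 1,
-- so only n, m ≤ N contribute to the coefficient of q^N.
psiCoeff : ℕ → ℕ → ℕ → ℤ
psiCoeff r s N =
  sumℤ (map (λ n → select (r ℕ.* tri n ℕ.+ s ℕ.* tri' n) N (-[1+ 0 ] ^ tri n)) (upTo (suc N)))
  + sumℤ (map (λ m → select (r ℕ.* tri' m ℕ.+ s ℕ.* tri m) N (- (-[1+ 0 ] ^ tri' m)))
                (map suc (upTo N)))

-- cList r s N = [c(N), c(N-1), …, c(0)], the coefficients of 1/Ψ(-q^r,q^s)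
-- determined by the reciprocal recursion c(0) = 1,
-- c(N) = - Σ_{j=1}^{N} ψ(j) c(N-j)   (ψ(0) = 1).
cList : ℕ → ℕ → ℕ → List ℤ
cList r s zero = + 1 ∷ []
cList r s (suc N) =
  - sumℤ (zipWith _*_ (map (λ i → psiCoeff r s (suc i)) (upTo (suc N))) prev) ∷ prev
  where prev = cList r s N

head0 : List ℤ → ℤ
head0 [] = + 0
head0 (x ∷ _) = x

c : ℕ → ℕ → ℕ → ℤ
c r s N = head0 (cList r s N)

module Submission where

-- Over 𝔽₂ let θₐ = Σ_{t ∈ ℤ} q^{(7t+a)²} and C = Σ c(n) qⁿ = 1/Ψ(-q⁹, q⁵).
-- As 7·(9·n(n+1)/2 + 5·n(n-1)/2) + 1 = (7n+1)², the series q·Ψ(-q⁶³, q³⁵) is θ₁, so C(q⁷)·θ₁ = q.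
-- By Frobenius θ₁⁸ = θ₁(q⁸), so C(q⁷)·θ₁(q⁸) = q·θ₁⁷; keeping only the terms q^{8L+1} on both sides,
-- D·θ₁ = (even part)³ of θ₁⁷ for D = Σ_L [q^{8L+1}]C(q⁷)·q^L. The 2-dissections
--   even part of θ₁ = θ₃(q²),   even part of θ₁θ₃ = θ₂θ₁   (from (X-Y)² + (X+Y)² = 2(X² + Y²))
-- evaluate the right side to θ₃θ₂θ₁, and cancelling θ₁ gives D = θ₃θ₂: c(N) ≡ [q^L]θ₃θ₂ when 7N = 8L + 1.
-- A nonzero coefficient of θ₃θ₂ writes L as a sum of two squares, impossible for L = 2^i·m with
-- m ≡ 3 (mod 4); the progressions of the theorem are 7N = 8·2^{3k+j}·(28n + a) + 1, (j, a) ∈ {(0, 27), (1, 3), (2, 19)}.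

module ParitySums where

  open import Data.Parity.Base using (Parity; 0ℙ; 1ℙ; _+_; _*_)
  open import Data.Parity.Properties using (+-assoc; p+p≡0ℙ; *-comm; *-zeroʳ; *-distribˡ-+; +-commutativeSemigroup)
  open import Algebra.Properties.CommutativeSemigroup +-commutativeSemigroup using (interchange)
  open import Data.List using (List; []; _∷_; _++_; map; cartesianProduct)
  open import Data.List.Membership.Propositional using (_∈_)
  open import Data.List.Relation.Unary.Any using (here; there)
  open import Data.Product using (∃-syntax; _×_; _,_; proj₁; proj₂)
  open import Data.Product.Properties using (≡-dec; ,-injective)
  open import Function using (_∘_)
  open import Relation.Binary.Definitions using (DecidableEquality)
  open import Relation.Binary.PropositionalEquality
    using (_≡_; _≢_; refl; sym; trans; cong; cong₂; _≗_; module ≡-Reasoning)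
  open import Relation.Nullary using (Dec; yes; no; ¬_; contradiction)

  private
    variable
      A B C D : Set
      P Q R : Set

  [_] : Dec P → Parity
  [ yes _ ] = 1ℙ
  [ no _ ] = 0ℙ

  []-yes : (p? : Dec P) → P → [ p? ] ≡ 1ℙ
  []-yes (yes _) _ = refl
  []-yes (no ¬p) p = contradiction p ¬p

  []-no : (p? : Dec P) → ¬ P → [ p? ] ≡ 0ℙ
  []-no (yes p) ¬p = contradiction p ¬p
  []-no (no _) _ = refl

  []≡1ℙ⇒ : (p? : Dec P) → [ p? ] ≡ 1ℙ → P
  []≡1ℙ⇒ (yes p) _ = p

  []-⇔ : (P → Q) → (Q → P) → (p? : Dec P) (q? : Dec Q) → [ p? ] ≡ [ q? ]
  []-⇔ _ _ (yes _) (yes _) = refl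
  []-⇔ _ _ (no _) (no _) = refl
  []-⇔ P⇒Q _ (yes p) (no ¬q) = contradiction (P⇒Q p) ¬q
  []-⇔ _ Q⇒P (no ¬p) (yes q) = contradiction (Q⇒P q) ¬p

  []-× : (R → P × Q) → (P × Q → R) → (p? : Dec P) (q? : Dec Q) (r? : Dec R) → [ r? ] ≡ [ p? ] * [ q? ]
  []-× _ _ (yes _) (yes _) (yes _) = refl
  []-× _ P×Q⇒R (yes p) (yes q) (no ¬r) = contradiction (P×Q⇒R (p , q)) ¬r
  []-× R⇒P×Q _ (yes _) (no ¬q) r? = []-no r? (¬q ∘ proj₂ ∘ R⇒P×Q)
  []-× R⇒P×Q _ (no ¬p) _ r? = []-no r? (¬p ∘ proj₁ ∘ R⇒P×Q)

  *-absorbʳ : (p s : Parity) → (p ≡ 1ℙ → s ≡ 1ℙ) → p * s ≡ p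
  *-absorbʳ 0ℙ s _ = refl
  *-absorbʳ 1ℙ s s≡1 = s≡1 refl

  *≡1ℙ⇒ˡ : (p s : Parity) → p * s ≡ 1ℙ → p ≡ 1ℙ
  *≡1ℙ⇒ˡ 1ℙ s _ = refl

  *≡1ℙ⇒ʳ : (p s : Parity) → p * s ≡ 1ℙ → s ≡ 1ℙ
  *≡1ℙ⇒ʳ 1ℙ s p*s≡1 = p*s≡1

  ≢1ℙ⇒≡0ℙ : (p : Parity) → p ≢ 1ℙ → p ≡ 0ℙ
  ≢1ℙ⇒≡0ℙ 0ℙ _ = refl
  ≢1ℙ⇒≡0ℙ 1ℙ p≢1 = contradiction refl p≢1

  ∑ : List A → (A → Parity) → Parity
  ∑ [] f = 0ℙ
  ∑ (x ∷ xs) f = f x + ∑ xs f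

  ∑-cong-∈ : (xs : List A) {f g : A → Parity} → (∀ {x} → x ∈ xs → f x ≡ g x) → ∑ xs f ≡ ∑ xs g
  ∑-cong-∈ [] _ = refl
  ∑-cong-∈ (x ∷ xs) f≡g = cong₂ _+_ (f≡g (here refl)) (∑-cong-∈ xs (f≡g ∘ there))

  ∑-cong : (xs : List A) {f g : A → Parity} → f ≗ g → ∑ xs f ≡ ∑ xs g
  ∑-cong xs f≗g = ∑-cong-∈ xs (λ {x} _ → f≗g x)

  ∑-zero : (xs : List A) {f : A → Parity} → (∀ {x} → x ∈ xs → f x ≡ 0ℙ) → ∑ xs f ≡ 0ℙ
  ∑-zero [] _ = refl
  ∑-zero (x ∷ xs) f≡0 = cong₂ _+_ (f≡0 (here refl)) (∑-zero xs (f≡0 ∘ there))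

  ∑-++ : (xs ys : List A) (f : A → Parity) → ∑ (xs ++ ys) f ≡ ∑ xs f + ∑ ys f
  ∑-++ [] ys f = refl
  ∑-++ (x ∷ xs) ys f = trans (cong (f x +_) (∑-++ xs ys f)) (sym (+-assoc (f x) _ _))

  ∑-map : (g : A → B) (xs : List A) (f : B → Parity) → ∑ (map g xs) f ≡ ∑ xs (f ∘ g)
  ∑-map g [] f = refl
  ∑-map g (x ∷ xs) f = cong (f (g x) +_) (∑-map g xs f)

  ∑-+ : (xs : List A) (f g : A → Parity) → ∑ xs (λ x → f x + g x) ≡ ∑ xs f + ∑ xs g
  ∑-+ [] f g = refl
  ∑-+ (x ∷ xs) f g = trans (cong (f x + g x +_) (∑-+ xs f g)) (interchange (f x) (g x) _ _)

  *-distribˡ-∑ : (c : Parity) (xs : List A) (f : A → Parity) → c * ∑ xs f ≡ ∑ xs (λ x → c * f x)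
  *-distribˡ-∑ c [] f = *-zeroʳ c
  *-distribˡ-∑ c (x ∷ xs) f = trans (*-distribˡ-+ c (f x) _) (cong (c * f x +_) (*-distribˡ-∑ c xs f))

  *-distribʳ-∑ : (c : Parity) (xs : List A) (f : A → Parity) → ∑ xs f * c ≡ ∑ xs (λ x → f x * c)
  *-distribʳ-∑ c xs f = trans (*-comm _ c) (trans (*-distribˡ-∑ c xs f) (∑-cong xs (λ x → *-comm c (f x))))

  *-distrib-∑∑ : (c d : Parity) (xs : List A) (ys : List B) (F : A → B → Parity) →
                 c * (∑ xs (λ x → ∑ ys (F x)) * d) ≡ ∑ xs (λ x → ∑ ys (λ y → c * (F x y * d)))
  *-distrib-∑∑ c d xs ys F = begin
    c * (∑ xs (λ x → ∑ ys (F x)) * d)            ≡⟨ cong (c *_) (*-distribʳ-∑ d xs _) ⟩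
    c * ∑ xs (λ x → ∑ ys (F x) * d)              ≡⟨ *-distribˡ-∑ c xs _ ⟩
    ∑ xs (λ x → c * (∑ ys (F x) * d))            ≡⟨ ∑-cong xs (λ x → cong (c *_) (*-distribʳ-∑ d ys (F x))) ⟩
    ∑ xs (λ x → c * ∑ ys (λ y → F x y * d))      ≡⟨ ∑-cong xs (λ x → *-distribˡ-∑ c ys _) ⟩
    ∑ xs (λ x → ∑ ys (λ y → c * (F x y * d)))    ∎
    where open ≡-Reasoning

  ∑-swap : (xs : List A) (ys : List B) (F : A → B → Parity) →
           ∑ xs (λ x → ∑ ys (F x)) ≡ ∑ ys (λ y → ∑ xs (λ x → F x y))
  ∑-swap [] ys F = sym (∑-zero ys (λ _ → refl))
  ∑-swap (x ∷ xs) ys F = trans (cong (∑ ys (F x) +_) (∑-swap xs ys F)) (sym (∑-+ ys (F x) _))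

  ∑-rotate₃ : (xs : List A) (ys : List B) (zs : List C) (F : A → B → C → Parity) →
              ∑ xs (λ x → ∑ ys (λ y → ∑ zs (F x y))) ≡ ∑ ys (λ y → ∑ zs (λ z → ∑ xs (λ x → F x y z)))
  ∑-rotate₃ xs ys zs F = trans (∑-swap xs ys _) (∑-cong ys (λ y → ∑-swap xs zs (λ x → F x y)))

  ∑-rotate₄ : (xs : List A) (ys : List B) (zs : List C) (ws : List D) (F : A → B → C → D → Parity) →
              ∑ xs (λ x → ∑ ys (λ y → ∑ zs (λ z → ∑ ws (F x y z)))) ≡
              ∑ ys (λ y → ∑ zs (λ z → ∑ ws (λ w → ∑ xs (λ x → F x y z w))))
  ∑-rotate₄ xs ys zs ws F = trans (∑-swap xs ys _) (∑-cong ys (λ y → ∑-rotate₃ xs zs ws (λ x → F x y)))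

  -- Off-diagonal terms cancel in pairs, as F x y + F y x = 0 in characteristic 2.
  ∑-diagonal : (xs : List A) (F : A → A → Parity) → (∀ x y → F x y ≡ F y x) →
               ∑ xs (λ x → ∑ xs (F x)) ≡ ∑ xs (λ x → F x x)
  ∑-diagonal [] F F-sym = refl
  ∑-diagonal (a ∷ xs) F F-sym = begin
    (F a a + Sₐ) + ∑ xs (λ x → F x a + ∑ xs (F x))
      ≡⟨ cong (F a a + Sₐ +_) (∑-+ xs (λ x → F x a) _) ⟩
    (F a a + Sₐ) + (∑ xs (λ x → F x a) + Rest)
      ≡⟨ cong (λ s → F a a + Sₐ + (s + Rest)) (∑-cong xs (λ x → F-sym x a)) ⟩
    (F a a + Sₐ) + (Sₐ + Rest)
      ≡⟨ +-assoc (F a a) Sₐ _ ⟩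
    F a a + (Sₐ + (Sₐ + Rest))
      ≡⟨ cong (F a a +_) (sym (+-assoc Sₐ Sₐ Rest)) ⟩
    F a a + ((Sₐ + Sₐ) + Rest)
      ≡⟨ cong (λ s → F a a + (s + Rest)) (p+p≡0ℙ Sₐ) ⟩
    F a a + Rest
      ≡⟨ cong (F a a +_) (∑-diagonal xs F F-sym) ⟩
    F a a + ∑ xs (λ x → F x x) ∎
    where
      open ≡-Reasoning
      Sₐ = ∑ xs (F a)
      Rest = ∑ xs (λ x → ∑ xs (F x))

  ∑-witness : (xs : List A) (f : A → Parity) → ∑ xs f ≡ 1ℙ → ∃[ x ] x ∈ xs × f x ≡ 1ℙ
  ∑-witness [] f ()
  ∑-witness (x ∷ xs) f ∑≡1 with f x in fx
  ... | 1ℙ = x , here refl , fx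
  ... | 0ℙ with ∑-witness xs f ∑≡1
  ...   | y , y∈xs , fy = y , there y∈xs , fy

  ∑-cartesianProduct : (xs : List A) (ys : List B) (F : A × B → Parity) →
                       ∑ (cartesianProduct xs ys) F ≡ ∑ xs (λ x → ∑ ys (λ y → F (x , y)))
  ∑-cartesianProduct [] ys F = refl
  ∑-cartesianProduct (x ∷ xs) ys F =
    trans (∑-++ (map (x ,_) ys) _ F) (cong₂ _+_ (∑-map (x ,_) ys F) (∑-cartesianProduct xs ys F))

  module Sifting {A : Set} (_≟_ : DecidableEquality A) where

    mult : List A → A → Parity
    mult xs a = ∑ xs (λ x → [ x ≟ a ])

    []-sym : (x y : A) → [ x ≟ y ] ≡ [ y ≟ x ]
    []-sym x y = []-⇔ sym sym (x ≟ y) (y ≟ x)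

    ∑-sift : (xs : List A) (a : A) (h : A → Parity) → ∑ xs (λ x → [ x ≟ a ] * h x) ≡ mult xs a * h a
    ∑-sift xs a h = trans (∑-cong xs at-a) (sym (*-distribʳ-∑ (h a) xs _))
      where
        at-a : ∀ x → [ x ≟ a ] * h x ≡ [ x ≟ a ] * h a
        at-a x with x ≟ a
        ... | yes refl = refl
        ... | no _ = refl

    -- Only multiplicities modulo 2 matter: φ need not be injective, nor the lists duplicate-free.
    ∑-reindex : (xs : List A) (ys : List B) {f : A → Parity} {g : B → Parity} (φ : B → A) →
                (∀ {y} → y ∈ ys → g y ≡ f (φ y)) →
                (∀ {y} → y ∈ ys → g y ≡ 1ℙ → mult xs (φ y) ≡ 1ℙ) →
                (∀ {x} → x ∈ xs → f x ≡ 1ℙ → ∑ ys (λ y → [ x ≟ φ y ]) ≡ 1ℙ) →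
                ∑ xs f ≡ ∑ ys g
    ∑-reindex xs ys {f} {g} φ g≡f∘φ g-support f-support = begin
      ∑ xs f
        ≡⟨ ∑-cong-∈ xs (λ x∈ → sym (*-absorbʳ _ _ (f-support x∈))) ⟩
      ∑ xs (λ x → f x * ∑ ys (λ y → [ x ≟ φ y ]))
        ≡⟨ ∑-cong xs (λ x → *-distribˡ-∑ (f x) ys _) ⟩
      ∑ xs (λ x → ∑ ys (λ y → f x * [ x ≟ φ y ]))
        ≡⟨ ∑-swap xs ys _ ⟩
      ∑ ys (λ y → ∑ xs (λ x → f x * [ x ≟ φ y ]))
        ≡⟨ ∑-cong-∈ ys (λ y∈ → ∑-cong xs (λ x → on-graph x y∈)) ⟩
      ∑ ys (λ y → ∑ xs (λ x → [ x ≟ φ y ] * g y))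
        ≡⟨ ∑-cong ys (λ y → sym (*-distribʳ-∑ (g y) xs _)) ⟩
      ∑ ys (λ y → mult xs (φ y) * g y)
        ≡⟨ ∑-cong-∈ ys (λ {y} y∈ → trans (*-comm _ (g y)) (*-absorbʳ _ _ (g-support y∈))) ⟩
      ∑ ys g ∎
      where
        open ≡-Reasoning
        on-graph : ∀ x {y} → y ∈ ys → f x * [ x ≟ φ y ] ≡ [ x ≟ φ y ] * g y
        on-graph x {y} y∈ with x ≟ φ y
        ... | yes refl = trans (*-comm (f (φ y)) 1ℙ) (sym (g≡f∘φ y∈))
        ... | no _ = *-zeroʳ (f x)

  module _ {A B : Set} (_≟ᴬ_ : DecidableEquality A) (_≟ᴮ_ : DecidableEquality B) where

    open Sifting (≡-dec _≟ᴬ_ _≟ᴮ_) using () renaming (mult to mult²)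
    open Sifting _≟ᴬ_ using () renaming (mult to multᴬ)
    open Sifting _≟ᴮ_ using () renaming (mult to multᴮ)

    []-pair : (x a : A) (y b : B) → [ ≡-dec _≟ᴬ_ _≟ᴮ_ (x , y) (a , b) ] ≡ [ x ≟ᴬ a ] * [ y ≟ᴮ b ]
    []-pair x a y b = []-× ,-injective (λ (x≡a , y≡b) → cong₂ _,_ x≡a y≡b)
                           (x ≟ᴬ a) (y ≟ᴮ b) (≡-dec _≟ᴬ_ _≟ᴮ_ (x , y) (a , b))

    mult-cartesianProduct : (xs : List A) (ys : List B) (a : A) (b : B) →
                            mult² (cartesianProduct xs ys) (a , b) ≡ multᴬ xs a * multᴮ ys b
    mult-cartesianProduct xs ys a b = begin
      mult² (cartesianProduct xs ys) (a , b)
        ≡⟨ ∑-cartesianProduct xs ys _ ⟩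
      ∑ xs (λ x → ∑ ys (λ y → [ ≡-dec _≟ᴬ_ _≟ᴮ_ (x , y) (a , b) ]))
        ≡⟨ ∑-cong xs (λ x → ∑-cong ys (λ y → []-pair x a y b)) ⟩
      ∑ xs (λ x → ∑ ys (λ y → [ x ≟ᴬ a ] * [ y ≟ᴮ b ]))
        ≡⟨ ∑-cong xs (λ x → *-distribˡ-∑ [ x ≟ᴬ a ] ys _) ⟨
      ∑ xs (λ x → [ x ≟ᴬ a ] * multᴮ ys b)
        ≡⟨ *-distribʳ-∑ (multᴮ ys b) xs _ ⟨
      multᴬ xs a * multᴮ ys b ∎
      where open ≡-Reasoning

module PowerSeries where

  open ParitySums
  open import Data.Parity.Base as ℙ using (Parity; 0ℙ; 1ℙ)
  import Data.Parity.Properties as ℙₚ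
  open import Data.Nat using (ℕ; zero; suc; _+_; _*_; _∸_; _≤_; _<_; z≤n; s≤s; NonZero)
  open import Data.Nat.Properties
  open import Data.Nat.DivMod
    using (_/_; _%_; m≡m%n+[m/n]*n; m*n%n≡0; m*n/n≡m; m%n<n; m<n*o⇒m/o<n; m/n≤m; m<n⇒m%n≡m; [m+kn]%n≡m%n)
  open import Data.List using ([]; _∷_; _∷ʳ_; upTo)
  open import Data.List.Properties using (upTo-∷ʳ; map-upTo)
  open import Data.List.Membership.Propositional using (_∈_)
  open import Data.List.Membership.Propositional.Properties using (∈-upTo⁻)
  open import Data.Sum using (inj₁; inj₂)
  open import Function using (_∘_)
  open import Level using (0ℓ)
  open import Algebra.Structures using (IsCommutativeSemigroup)
  open import Algebra.Bundles using (CommutativeSemigroup)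
  open import Relation.Binary.PropositionalEquality
    using (_≡_; _≢_; refl; sym; trans; cong; cong₂; _≗_; module ≡-Reasoning)
  open import Relation.Nullary using (Dec; yes; no)
  import Relation.Binary.Reasoning.Setoid

  open Sifting _≟_ public

  ∑-upTo-suc : (n : ℕ) (f : ℕ → Parity) → ∑ (upTo (suc n)) f ≡ ∑ (upTo n) f ℙ.+ f n
  ∑-upTo-suc n f = begin
    ∑ (upTo (suc n)) f                  ≡⟨ cong (λ xs → ∑ xs f) (upTo-∷ʳ n) ⟨
    ∑ (upTo n ∷ʳ n) f                   ≡⟨ ∑-++ (upTo n) (n ∷ []) f ⟩
    ∑ (upTo n) f ℙ.+ (f n ℙ.+ 0ℙ)       ≡⟨ cong (∑ (upTo n) f ℙ.+_) (ℙₚ.+-identityʳ (f n)) ⟩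
    ∑ (upTo n) f ℙ.+ f n                ∎
    where open ≡-Reasoning

  ∑-upTo-head : (n : ℕ) (f : ℕ → Parity) → ∑ (upTo (suc n)) f ≡ f 0 ℙ.+ ∑ (upTo n) (f ∘ suc)
  ∑-upTo-head n f = cong (f 0 ℙ.+_) (trans (cong (λ xs → ∑ xs f) (sym (map-upTo suc n))) (∑-map suc (upTo n) f))

  ∑-upTo-truncate : ∀ {m M} (f : ℕ → Parity) → m ≤ M → (∀ {k} → m ≤ k → f k ≡ 0ℙ) →
                    ∑ (upTo M) f ≡ ∑ (upTo m) f
  ∑-upTo-truncate {M = zero} f z≤n _ = refl
  ∑-upTo-truncate {m} {suc M} f m≤1+M f≡0 with m≤n⇒m<n∨m≡n m≤1+M
  ... | inj₂ refl = refl
  ... | inj₁ m<1+M = begin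
    ∑ (upTo (suc M)) f      ≡⟨ ∑-upTo-suc M f ⟩
    ∑ (upTo M) f ℙ.+ f M    ≡⟨ cong₂ ℙ._+_ (∑-upTo-truncate f (≤-pred m<1+M) f≡0) (f≡0 (≤-pred m<1+M)) ⟩
    ∑ (upTo m) f ℙ.+ 0ℙ     ≡⟨ ℙₚ.+-identityʳ _ ⟩
    ∑ (upTo m) f            ∎
    where open ≡-Reasoning

  mult-upTo : ∀ {k M} → k < M → mult (upTo M) k ≡ 1ℙ
  mult-upTo {k} {suc M} k<1+M with m≤n⇒m<n∨m≡n (≤-pred k<1+M)
  ... | inj₁ k<M = trans (∑-upTo-suc M _) (cong₂ ℙ._+_ (mult-upTo k<M) ([]-no (M ≟ k) (λ M≡k → <-irrefl (sym M≡k) k<M)))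
  ... | inj₂ refl = trans (∑-upTo-suc k _) (cong₂ ℙ._+_ below-k ([]-yes (k ≟ k) refl))
    where
      below-k : mult (upTo k) k ≡ 0ℙ
      below-k = ∑-zero (upTo k) (λ x∈ → []-no (_ ≟ k) (<⇒≢ (∈-upTo⁻ x∈)))

  ∑-upTo-sift-+ : ∀ {n M} → n < M → (i : ℕ) (h : ℕ → Parity) →
                  ∑ (upTo M) (λ j → [ i + j ≟ n ] ℙ.* h j) ≡ [ i ≤? n ] ℙ.* h (n ∸ i)
  ∑-upTo-sift-+ {n} {M} n<M i h with i ≤? n
  ... | yes i≤n = begin
    ∑ (upTo M) (λ j → [ i + j ≟ n ] ℙ.* h j)    ≡⟨ ∑-cong (upTo M) (λ j → cong (ℙ._* h j) (i+j≟n⇔j≟n∸i j)) ⟩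
    ∑ (upTo M) (λ j → [ j ≟ n ∸ i ] ℙ.* h j)    ≡⟨ ∑-sift (upTo M) (n ∸ i) h ⟩
    mult (upTo M) (n ∸ i) ℙ.* h (n ∸ i)        ≡⟨ cong (ℙ._* h (n ∸ i)) (mult-upTo (≤-<-trans (m∸n≤m n i) n<M)) ⟩
    h (n ∸ i)                                  ∎
    where
      open ≡-Reasoning
      i+j≟n⇔j≟n∸i : ∀ j → [ i + j ≟ n ] ≡ [ j ≟ n ∸ i ]
      i+j≟n⇔j≟n∸i j = []-⇔ (λ { refl → sym (m+n∸m≡n i j) }) (λ { refl → m+[n∸m]≡n i≤n }) (i + j ≟ n) (j ≟ n ∸ i)
  ... | no i≰n = ∑-zero (upTo M) (λ {j} _ → cong (ℙ._* h j) ([]-no (i + j ≟ n) (i≰n ∘ m+n≤o⇒m≤o i ∘ ≤-reflexive)))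

  ∑-upTo-sift-∘ : ∀ {n M} → n < M → (i j l : ℕ) →
                  ∑ (upTo M) (λ a → [ a + l ≟ n ] ℙ.* [ i + j ≟ a ]) ≡ [ i + j + l ≟ n ]
  ∑-upTo-sift-∘ {n} {M} n<M i j l = begin
    ∑ (upTo M) (λ a → [ a + l ≟ n ] ℙ.* [ i + j ≟ a ])   ≡⟨ ∑-cong (upTo M) flip ⟩
    ∑ (upTo M) (λ a → [ a ≟ i + j ] ℙ.* [ a + l ≟ n ])   ≡⟨ ∑-sift (upTo M) (i + j) (λ a → [ a + l ≟ n ]) ⟩
    mult (upTo M) (i + j) ℙ.* [ i + j + l ≟ n ]          ≡⟨ drop-mult (i + j <? M) ⟩
    [ i + j + l ≟ n ]                                   ∎
    where
      open ≡-Reasoning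
      flip : ∀ a → [ a + l ≟ n ] ℙ.* [ i + j ≟ a ] ≡ [ a ≟ i + j ] ℙ.* [ a + l ≟ n ]
      flip a = trans (ℙₚ.*-comm [ a + l ≟ n ] [ i + j ≟ a ]) (cong (ℙ._* [ a + l ≟ n ]) ([]-sym (i + j) a))
      drop-mult : Dec (i + j < M) → mult (upTo M) (i + j) ℙ.* [ i + j + l ≟ n ] ≡ [ i + j + l ≟ n ]
      drop-mult (yes i+j<M) = cong (ℙ._* _) (mult-upTo i+j<M)
      drop-mult (no i+j≮M) = trans (cong (mult (upTo M) (i + j) ℙ.*_) too-big) (trans (ℙₚ.*-zeroʳ _) (sym too-big))
        where
          too-big : [ i + j + l ≟ n ] ≡ 0ℙ
          too-big = []-no (i + j + l ≟ n) (λ i+j+l≡n → i+j≮M (≤-<-trans (m+n≤o⇒m≤o (i + j) (≤-reflexive i+j+l≡n)) n<M))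

  ∑-upTo-sift-∸ : ∀ x y n → ∑ (upTo (suc n)) (λ i → [ x ≟ i ] ℙ.* [ y ≟ n ∸ i ]) ≡ [ x + y ≟ n ]
  ∑-upTo-sift-∸ x y n with x ≤? n
  ... | yes x≤n = begin
    ∑ (upTo (suc n)) (λ i → [ x ≟ i ] ℙ.* [ y ≟ n ∸ i ])
      ≡⟨ ∑-cong (upTo (suc n)) (λ i → cong (ℙ._* [ y ≟ n ∸ i ]) ([]-sym x i)) ⟩
    ∑ (upTo (suc n)) (λ i → [ i ≟ x ] ℙ.* [ y ≟ n ∸ i ])
      ≡⟨ ∑-sift (upTo (suc n)) x (λ i → [ y ≟ n ∸ i ]) ⟩
    mult (upTo (suc n)) x ℙ.* [ y ≟ n ∸ x ]
      ≡⟨ cong (ℙ._* [ y ≟ n ∸ x ]) (mult-upTo (s≤s x≤n)) ⟩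
    [ y ≟ n ∸ x ]
      ≡⟨ []-⇔ (λ { refl → m+[n∸m]≡n x≤n }) (λ { refl → sym (m+n∸m≡n x y) })
                  (y ≟ n ∸ x) (x + y ≟ n) ⟩
    [ x + y ≟ n ] ∎
    where open ≡-Reasoning
  ... | no x≰n = trans (∑-zero (upTo (suc n)) (λ {i} i∈ → cong (ℙ._* [ y ≟ n ∸ i ])
                         ([]-no (x ≟ i) (λ { refl → x≰n (≤-pred (∈-upTo⁻ i∈)) }))))
                      (sym ([]-no (x + y ≟ n) (λ x+y≡n → x≰n (m+n≤o⇒m≤o x (≤-reflexive x+y≡n)))))

  Series : Set
  Series = ℕ → Parity

  infixl 7 _⊛_
  _⊛_ : Series → Series → Series
  (f ⊛ g) n = ∑ (upTo (suc n)) (λ i → f i ℙ.* g (n ∸ i))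

  ⊛-square : ∀ {n M} → n < M → (f g : Series) →
             (f ⊛ g) n ≡ ∑ (upTo M) (λ i → ∑ (upTo M) (λ j → [ i + j ≟ n ] ℙ.* (f i ℙ.* g j)))
  ⊛-square {n} {M} n<M f g = sym (begin
    ∑ (upTo M) (λ i → ∑ (upTo M) (λ j → [ i + j ≟ n ] ℙ.* (f i ℙ.* g j)))
      ≡⟨ ∑-cong (upTo M) (λ i → ∑-upTo-sift-+ n<M i (λ j → f i ℙ.* g j)) ⟩
    ∑ (upTo M) (λ i → [ i ≤? n ] ℙ.* (f i ℙ.* g (n ∸ i)))
      ≡⟨ ∑-upTo-truncate _ n<M (λ {k} n<k → cong (ℙ._* (f k ℙ.* g (n ∸ k))) ([]-no (k ≤? n) (<⇒≱ n<k))) ⟩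
    ∑ (upTo (suc n)) (λ i → [ i ≤? n ] ℙ.* (f i ℙ.* g (n ∸ i)))
      ≡⟨ ∑-cong-∈ (upTo (suc n)) (λ {i} i∈ → cong (ℙ._* (f i ℙ.* g (n ∸ i))) ([]-yes (i ≤? n) (≤-pred (∈-upTo⁻ i∈)))) ⟩
    (f ⊛ g) n ∎)
    where open ≡-Reasoning

  ⊛-comm : (f g : Series) → f ⊛ g ≗ g ⊛ f
  ⊛-comm f g n = begin
    (f ⊛ g) n                                                ≡⟨ ⊛-square ≤-refl f g ⟩
    ∑ U (λ i → ∑ U (λ j → [ i + j ≟ n ] ℙ.* (f i ℙ.* g j)))  ≡⟨ ∑-swap U U (λ i j → [ i + j ≟ n ] ℙ.* (f i ℙ.* g j)) ⟩
    ∑ U (λ j → ∑ U (λ i → [ i + j ≟ n ] ℙ.* (f i ℙ.* g j)))  ≡⟨ ∑-cong U (λ j → ∑-cong U (λ i → flip i j)) ⟩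
    ∑ U (λ j → ∑ U (λ i → [ j + i ≟ n ] ℙ.* (g j ℙ.* f i)))  ≡⟨ ⊛-square ≤-refl g f ⟨
    (g ⊛ f) n                                                ∎
    where
      open ≡-Reasoning
      U = upTo (suc n)
      flip : ∀ i j → [ i + j ≟ n ] ℙ.* (f i ℙ.* g j) ≡ [ j + i ≟ n ] ℙ.* (g j ℙ.* f i)
      flip i j = cong₂ ℙ._*_ (cong (λ k → [ k ≟ n ]) (+-comm i j)) (ℙₚ.*-comm (f i) (g j))

  triple : Series → Series → Series → Series
  triple f g h n = ∑ U (λ i → ∑ U (λ j → ∑ U (λ l → [ i + j + l ≟ n ] ℙ.* (f i ℙ.* g j ℙ.* h l))))
    where U = upTo (suc n)

  ⊛⊛≗triple : (f g h : Series) → (f ⊛ g) ⊛ h ≗ triple f g h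
  ⊛⊛≗triple f g h n = begin
    ((f ⊛ g) ⊛ h) n
      ≡⟨ ⊛-square ≤-refl (f ⊛ g) h ⟩
    ∑ U (λ a → ∑ U (λ l → [ a + l ≟ n ] ℙ.* ((f ⊛ g) a ℙ.* h l)))
      ≡⟨ ∑-cong-∈ U (λ a∈ → ∑-cong U (expand (∈-upTo⁻ a∈))) ⟩
    ∑ U (λ a → ∑ U (λ l → ∑ U (λ i → ∑ U (λ j → T a l i j))))
      ≡⟨ ∑-rotate₄ U U U U T ⟩
    ∑ U (λ l → ∑ U (λ i → ∑ U (λ j → ∑ U (λ a → T a l i j))))
      ≡⟨ ∑-cong U (λ l → ∑-cong U (λ i → ∑-cong U (sift-a l i))) ⟩
    ∑ U (λ l → ∑ U (λ i → ∑ U (λ j → [ i + j + l ≟ n ] ℙ.* fgh i j l)))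
      ≡⟨ ∑-rotate₃ U U U (λ l i j → [ i + j + l ≟ n ] ℙ.* fgh i j l) ⟩
    triple f g h n ∎
    where
      open ≡-Reasoning
      U = upTo (suc n)
      fgh : ℕ → ℕ → ℕ → Parity
      fgh i j l = f i ℙ.* g j ℙ.* h l
      T : ℕ → ℕ → ℕ → ℕ → Parity
      T a l i j = ([ a + l ≟ n ] ℙ.* [ i + j ≟ a ]) ℙ.* fgh i j l
      expand : ∀ {a} → a < suc n → ∀ l → [ a + l ≟ n ] ℙ.* ((f ⊛ g) a ℙ.* h l) ≡ ∑ U (λ i → ∑ U (T a l i))
      expand {a} a<1+n l = begin
        c ℙ.* ((f ⊛ g) a ℙ.* h l)
          ≡⟨ cong (λ s → c ℙ.* (s ℙ.* h l)) (⊛-square a<1+n f g) ⟩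
        c ℙ.* (∑ U (λ i → ∑ U (F i)) ℙ.* h l)
          ≡⟨ *-distrib-∑∑ c (h l) U U F ⟩
        ∑ U (λ i → ∑ U (λ j → c ℙ.* (F i j ℙ.* h l)))
          ≡⟨ ∑-cong U (λ i → ∑-cong U (reassoc i)) ⟩
        ∑ U (λ i → ∑ U (T a l i)) ∎
        where
          c = [ a + l ≟ n ]
          F : ℕ → ℕ → Parity
          F i j = [ i + j ≟ a ] ℙ.* (f i ℙ.* g j)
          reassoc : ∀ i j → c ℙ.* (F i j ℙ.* h l) ≡ T a l i j
          reassoc i j = trans (cong (c ℙ.*_) (ℙₚ.*-assoc [ i + j ≟ a ] (f i ℙ.* g j) (h l)))
                              (sym (ℙₚ.*-assoc c [ i + j ≟ a ] (fgh i j l)))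
      sift-a : ∀ l i j → ∑ U (λ a → T a l i j) ≡ [ i + j + l ≟ n ] ℙ.* fgh i j l
      sift-a l i j = trans (sym (*-distribʳ-∑ (fgh i j l) U (λ a → [ a + l ≟ n ] ℙ.* [ i + j ≟ a ])))
                           (cong (ℙ._* fgh i j l) (∑-upTo-sift-∘ ≤-refl i j l))

  triple-rotate : (f g h : Series) → triple f g h ≗ triple g h f
  triple-rotate f g h n = trans (∑-rotate₃ U U U (λ l i j → [ l + i + j ≟ n ] ℙ.* (f l ℙ.* g i ℙ.* h j)))
                                (∑-cong U (λ i → ∑-cong U (λ j → ∑-cong U (λ l → rotate l i j))))
    where
      U = upTo (suc n)
      rotate : ∀ l i j → [ l + i + j ≟ n ] ℙ.* (f l ℙ.* g i ℙ.* h j) ≡ [ i + j + l ≟ n ] ℙ.* (g i ℙ.* h j ℙ.* f l)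
      rotate l i j = cong₂ ℙ._*_ (cong (λ k → [ k ≟ n ]) (trans (+-assoc l i j) (+-comm l (i + j))))
                                 (trans (ℙₚ.*-assoc (f l) (g i) (h j)) (ℙₚ.*-comm (f l) _))

  ⊛-assoc : (f g h : Series) → (f ⊛ g) ⊛ h ≗ f ⊛ (g ⊛ h)
  ⊛-assoc f g h n = begin
    ((f ⊛ g) ⊛ h) n   ≡⟨ ⊛⊛≗triple f g h n ⟩
    triple f g h n    ≡⟨ triple-rotate f g h n ⟩
    triple g h f n    ≡⟨ ⊛⊛≗triple g h f n ⟨
    ((g ⊛ h) ⊛ f) n   ≡⟨ ⊛-comm (g ⊛ h) f n ⟩
    (f ⊛ (g ⊛ h)) n   ∎
    where open ≡-Reasoning

  ⊛-cong : {f f′ g g′ : Series} → f ≗ f′ → g ≗ g′ → f ⊛ g ≗ f′ ⊛ g′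
  ⊛-cong f≗f′ g≗g′ n = ∑-cong (upTo (suc n)) (λ i → cong₂ ℙ._*_ (f≗f′ i) (g≗g′ (n ∸ i)))

  ⊛-congˡ : (f : Series) {g g′ : Series} → g ≗ g′ → f ⊛ g ≗ f ⊛ g′
  ⊛-congˡ f = ⊛-cong {f} {f} (λ _ → refl)

  ⊛-congʳ : (g : Series) {f f′ : Series} → f ≗ f′ → f ⊛ g ≗ f′ ⊛ g
  ⊛-congʳ g f≗f′ = ⊛-cong {g = g} {g} f≗f′ (λ _ → refl)

  ⊛-isCommutativeSemigroup : IsCommutativeSemigroup _≗_ _⊛_
  ⊛-isCommutativeSemigroup = record
    { isSemigroup = record
      { isMagma = record
        { isEquivalence = record
          { refl = λ _ → refl ; sym = λ p x → sym (p x) ; trans = λ p q x → trans (p x) (q x) }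
        ; ∙-cong = ⊛-cong
        }
      ; assoc = ⊛-assoc
      }
    ; comm = ⊛-comm
    }

  ⊛-commutativeSemigroup : CommutativeSemigroup 0ℓ 0ℓ
  ⊛-commutativeSemigroup = record { isCommutativeSemigroup = ⊛-isCommutativeSemigroup }

  module ≗-Reasoning = Relation.Binary.Reasoning.Setoid (CommutativeSemigroup.setoid ⊛-commutativeSemigroup)

  open import Algebra.Properties.CommutativeSemigroup ⊛-commutativeSemigroup using (interchange)

  0ₛ 1ₛ q : Series
  0ₛ _ = 0ℙ
  1ₛ n = [ n ≟ 0 ]
  q n = [ n ≟ 1 ]

  ⊛-zeroʳ : (f : Series) → f ⊛ 0ₛ ≗ 0ₛ
  ⊛-zeroʳ f n = ∑-zero (upTo (suc n)) (λ {i} _ → ℙₚ.*-zeroʳ (f i))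

  q-⊛ : (f : Series) (n : ℕ) → (q ⊛ f) (suc n) ≡ f n
  q-⊛ f n = trans (∑-sift (upTo (suc (suc n))) 1 (λ i → f (suc n ∸ i)))
                  (cong (ℙ._* f n) (mult-upTo {M = suc (suc n)} (s≤s (s≤s z≤n))))

  q-cancel : {f g : Series} → q ⊛ f ≗ q ⊛ g → f ≗ g
  q-cancel {f} {g} qf≗qg n = trans (sym (q-⊛ f n)) (trans (qf≗qg (suc n)) (q-⊛ g n))

  dilate : (k : ℕ) .{{_ : NonZero k}} → Series → Series
  dilate k f n = [ n % k ≟ 0 ] ℙ.* f (n / k)

  dissect : (k r : ℕ) → Series → Series
  dissect k r f n = f (r + n * k)

  dissect-cong : (k r : ℕ) {f g : Series} → f ≗ g → dissect k r f ≗ dissect k r g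
  dissect-cong k r f≗g n = f≗g (r + n * k)

  module _ (k : ℕ) .{{_ : NonZero k}} where

    dilate-cong : {f g : Series} → f ≗ g → dilate k f ≗ dilate k g
    dilate-cong f≗g n = cong ([ n % k ≟ 0 ] ℙ.*_) (f≗g (n / k))

    dilate-* : (f : Series) (m : ℕ) → dilate k f (m * k) ≡ f m
    dilate-* f m = cong₂ ℙ._*_ ([]-yes (m * k % k ≟ 0) (m*n%n≡0 m k)) (cong f (m*n/n≡m m k))

    dilate-support : (f : Series) {n : ℕ} → dilate k f n ≡ 1ℙ → n ≡ n / k * k
    dilate-support f {n} fn≡1 = trans (m≡m%n+[m/n]*n n k) (cong (_+ n / k * k) n%k≡0)
      where n%k≡0 = []≡1ℙ⇒ (n % k ≟ 0) (*≡1ℙ⇒ˡ _ _ fn≡1)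

    dissect-dilate : ∀ {r} → 0 < r → r < k → (f : Series) → dissect k r (dilate k f) ≗ 0ₛ
    dissect-dilate {r} 0<r r<k f m = cong (ℙ._* f ((r + m * k) / k)) ([]-no ((r + m * k) % k ≟ 0) r+mk%k≢0)
      where
        r+mk%k≢0 : (r + m * k) % k ≢ 0
        r+mk%k≢0 r+mk%k≡0 = <⇒≢ 0<r (sym (trans (sym (m<n⇒m%n≡m r<k)) (trans (sym ([m+kn]%n≡m%n r m k)) r+mk%k≡0)))

    dissect-ext : {f g : Series} → (∀ {r} → r < k → dissect k r f ≗ dissect k r g) → f ≗ g
    dissect-ext {f} {g} dissect≗ n = begin
      f n                      ≡⟨ cong f (m≡m%n+[m/n]*n n k) ⟩
      f (n % k + n / k * k)    ≡⟨ dissect≗ (m%n<n n k) (n / k) ⟩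
      g (n % k + n / k * k)    ≡⟨ cong g (m≡m%n+[m/n]*n n k) ⟨
      g n                      ∎
      where open ≡-Reasoning

    dissect-dilate-⊛ : ∀ {r} → r < k → (f g : Series) → dissect k r (dilate k f ⊛ g) ≗ f ⊛ dissect k r g
    dissect-dilate-⊛ {r} r<k f g N =
      ∑-reindex (upTo (suc (r + N * k))) (upTo (suc N)) (_* k) on-image image-in-range preimage-unique
      where
        on-image : ∀ {a} → a ∈ upTo (suc N) → f a ℙ.* g (r + (N ∸ a) * k) ≡ dilate k f (a * k) ℙ.* g (r + N * k ∸ a * k)
        on-image {a} a∈ = cong₂ ℙ._*_ (sym (dilate-* f a)) (cong g (sym (begin
          r + N * k ∸ a * k      ≡⟨ +-∸-assoc r (*-monoˡ-≤ k (≤-pred (∈-upTo⁻ a∈))) ⟩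
          r + (N * k ∸ a * k)    ≡⟨ cong (r +_) (*-distribʳ-∸ k N a) ⟨
          r + (N ∸ a) * k        ∎)))
          where open ≡-Reasoning
        image-in-range : ∀ {a} → a ∈ upTo (suc N) → _ → mult (upTo (suc (r + N * k))) (a * k) ≡ 1ℙ
        image-in-range a∈ _ = mult-upTo (s≤s (≤-trans (*-monoˡ-≤ k (≤-pred (∈-upTo⁻ a∈))) (m≤n+m (N * k) r)))
        preimage-unique : ∀ {i} → i ∈ upTo (suc (r + N * k)) → dilate k f i ℙ.* g (r + N * k ∸ i) ≡ 1ℙ →
                          ∑ (upTo (suc N)) (λ a → [ i ≟ a * k ]) ≡ 1ℙ
        preimage-unique {i} i∈ term≡1 = trans (∑-cong (upTo (suc N)) i≟a*k⇔a≟i/k) (mult-upTo i/k≤N)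
          where
            i≡i/k*k = dilate-support f (*≡1ℙ⇒ˡ _ _ term≡1)
            i≟a*k⇔a≟i/k : ∀ a → [ i ≟ a * k ] ≡ [ a ≟ i / k ]
            i≟a*k⇔a≟i/k a = []-⇔ (λ { refl → sym (m*n/n≡m a k) }) (λ a≡i/k → trans i≡i/k*k (cong (_* k) (sym a≡i/k)))
                                 (i ≟ a * k) (a ≟ i / k)
            i/k≤N : i / k < suc N
            i/k≤N = m<n*o⇒m/o<n (≤-trans (∈-upTo⁻ i∈) (+-monoˡ-≤ (N * k) r<k))

    ∑-upTo-sift-* : ∀ {n M} → n < M → (h : Series) → ∑ (upTo M) (λ i → [ i * k ≟ n ] ℙ.* h i) ≡ dilate k h n
    ∑-upTo-sift-* {n} {M} n<M h with n % k ≟ 0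
    ... | yes n%k≡0 = begin
      ∑ (upTo M) (λ i → [ i * k ≟ n ] ℙ.* h i)     ≡⟨ ∑-cong (upTo M) (λ i → cong (ℙ._* h i) (i*k≟n⇔i≟n/k i)) ⟩
      ∑ (upTo M) (λ i → [ i ≟ n / k ] ℙ.* h i)     ≡⟨ ∑-sift (upTo M) (n / k) h ⟩
      mult (upTo M) (n / k) ℙ.* h (n / k)         ≡⟨ cong (ℙ._* h (n / k)) (mult-upTo (≤-<-trans (m/n≤m n k) n<M)) ⟩
      h (n / k)                                   ∎
      where
        open ≡-Reasoning
        n≡n/k*k = trans (m≡m%n+[m/n]*n n k) (cong (_+ n / k * k) n%k≡0)
        i*k≟n⇔i≟n/k : ∀ i → [ i * k ≟ n ] ≡ [ i ≟ n / k ]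
        i*k≟n⇔i≟n/k i = []-⇔ (λ { refl → sym (m*n/n≡m i k) }) (λ i≡n/k → trans (cong (_* k) i≡n/k) (sym n≡n/k*k))
                              (i * k ≟ n) (i ≟ n / k)
    ... | no n%k≢0 = ∑-zero (upTo M) (λ {i} _ → cong (ℙ._* h i) ([]-no (i * k ≟ n) (λ { refl → n%k≢0 (m*n%n≡0 i k) })))

  ⊛-self : (f : Series) → f ⊛ f ≗ dilate 2 f
  ⊛-self f n = begin
    (f ⊛ f) n
      ≡⟨ ⊛-square ≤-refl f f ⟩
    ∑ U (λ i → ∑ U (λ j → [ i + j ≟ n ] ℙ.* (f i ℙ.* f j)))
      ≡⟨ ∑-diagonal U (λ i j → [ i + j ≟ n ] ℙ.* (f i ℙ.* f j)) symmetric ⟩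
    ∑ U (λ i → [ i + i ≟ n ] ℙ.* (f i ℙ.* f i))
      ≡⟨ ∑-cong U (λ i → cong₂ ℙ._*_ (cong (λ m → [ m ≟ n ]) (i+i≡i*2 i))
                                        (ℙₚ.*-idem (f i))) ⟩
    ∑ U (λ i → [ i * 2 ≟ n ] ℙ.* f i)
      ≡⟨ ∑-upTo-sift-* 2 {n} ≤-refl f ⟩
    dilate 2 f n ∎
    where
      open ≡-Reasoning
      U = upTo (suc n)
      symmetric : ∀ i j → [ i + j ≟ n ] ℙ.* (f i ℙ.* f j) ≡ [ j + i ≟ n ] ℙ.* (f j ℙ.* f i)
      symmetric i j = cong₂ ℙ._*_ (cong (λ m → [ m ≟ n ]) (+-comm i j)) (ℙₚ.*-comm (f i) (f j))
      i+i≡i*2 : ∀ i → i + i ≡ i * 2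
      i+i≡i*2 i = trans (cong (i +_) (sym (+-identityʳ i))) (*-comm 2 i)

  dilate-⊛ : (f g : Series) → dilate 2 (f ⊛ g) ≗ dilate 2 f ⊛ dilate 2 g
  dilate-⊛ f g = begin
    dilate 2 (f ⊛ g)          ≈⟨ ⊛-self (f ⊛ g) ⟨
    (f ⊛ g) ⊛ (f ⊛ g)         ≈⟨ interchange f g f g ⟩
    (f ⊛ f) ⊛ (g ⊛ g)         ≈⟨ ⊛-cong (⊛-self f) (⊛-self g) ⟩
    dilate 2 f ⊛ dilate 2 g   ∎
    where open ≗-Reasoning

  ⊛-self-⊛-dilate : (f g : Series) → f ⊛ (f ⊛ dilate 2 g) ≗ dilate 2 (f ⊛ g)
  ⊛-self-⊛-dilate f g = begin
    f ⊛ (f ⊛ dilate 2 g)      ≈⟨ ⊛-assoc f f (dilate 2 g) ⟨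
    (f ⊛ f) ⊛ dilate 2 g      ≈⟨ ⊛-congʳ (dilate 2 g) (⊛-self f) ⟩
    dilate 2 f ⊛ dilate 2 g   ≈⟨ dilate-⊛ f g ⟨
    dilate 2 (f ⊛ g)          ∎
    where open ≗-Reasoning

  -- f ↦ Σₙ f(8n + 1) qⁿ.
  dissect₈₁ : Series → Series
  dissect₈₁ f = dissect 2 0 (dissect 2 0 (dissect 2 1 f))

  dissect₈₁-cong : {f g : Series} → f ≗ g → dissect₈₁ f ≗ dissect₈₁ g
  dissect₈₁-cong = dissect-cong 2 0 ∘ dissect-cong 2 0 ∘ dissect-cong 2 1

  dissect₈₁-dilate³-⊛ : (f g : Series) → dissect₈₁ (dilate 2 (dilate 2 (dilate 2 f)) ⊛ g) ≗ f ⊛ dissect₈₁ g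
  dissect₈₁-dilate³-⊛ f g = begin
    E (E (O (dilate 2 (dilate 2 (dilate 2 f)) ⊛ g)))
      ≈⟨ E-cong (E-cong (dissect-dilate-⊛ 2 (s≤s (s≤s z≤n)) (dilate 2 (dilate 2 f)) g)) ⟩
    E (E (dilate 2 (dilate 2 f) ⊛ O g))
      ≈⟨ E-cong (dissect-dilate-⊛ 2 (s≤s z≤n) (dilate 2 f) (O g)) ⟩
    E (dilate 2 f ⊛ E (O g))
      ≈⟨ dissect-dilate-⊛ 2 (s≤s z≤n) f (E (O g)) ⟩
    f ⊛ E (E (O g)) ∎
    where
      open ≗-Reasoning
      E = dissect 2 0
      O = dissect 2 1
      E-cong = dissect-cong 2 0

  dissect₂₁-q⊛ : (f : Series) → dissect 2 1 (q ⊛ f) ≗ dissect 2 0 f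
  dissect₂₁-q⊛ f n = q-⊛ f (n * 2)

module IntegerParity where

  open import Data.Parity.Base as ℙ using (Parity; 0ℙ; 1ℙ)
  import Data.Parity.Properties as ℙₚ
  open import Data.Nat as ℕ using (zero; suc; _≤_; parity)
  import Data.Nat.Properties as ℕₚ
  open import Data.Integer as ℤ using (ℤ; +_; -[1+_]; ∣_∣; -_; _⊖_)
  import Data.Integer.Properties as ℤₚ
  open import Data.Product using (∃-syntax; _,_)
  open import Function using (_∘_)
  open import Relation.Binary.PropositionalEquality using (_≡_; refl; sym; trans; cong; module ≡-Reasoning)
  open import Relation.Nullary using (yes; no)

  parity-∸ : ∀ {m n} → n ≤ m → parity (m ℕ.∸ n) ≡ parity m ℙ.+ parity n
  parity-∸ {m} {n} n≤m = begin
    parity (m ℕ.∸ n)                            ≡⟨ ℙₚ.+-identityʳ _ ⟨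
    parity (m ℕ.∸ n) ℙ.+ 0ℙ                     ≡⟨ cong (parity (m ℕ.∸ n) ℙ.+_) (ℙₚ.p+p≡0ℙ (parity n)) ⟨
    parity (m ℕ.∸ n) ℙ.+ (parity n ℙ.+ parity n) ≡⟨ ℙₚ.+-assoc (parity (m ℕ.∸ n)) _ _ ⟨
    parity (m ℕ.∸ n) ℙ.+ parity n ℙ.+ parity n   ≡⟨ cong (ℙ._+ parity n) (ℙₚ.+-homo-+ (m ℕ.∸ n) n) ⟨
    parity (m ℕ.∸ n ℕ.+ n) ℙ.+ parity n         ≡⟨ cong (λ k → parity k ℙ.+ parity n) (ℕₚ.m∸n+n≡m n≤m) ⟩
    parity m ℙ.+ parity n                       ∎
    where open ≡-Reasoning

  parity-*2 : ∀ m → parity (m ℕ.* 2) ≡ 0ℙ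
  parity-*2 m = trans (ℙₚ.*-homo-* m 2) (ℙₚ.*-zeroʳ (parity m))

  parity≡0ℙ⇒even : ∀ n → parity n ≡ 0ℙ → ∃[ k ] n ≡ k ℕ.+ k
  parity≡0ℙ⇒even zero _ = 0 , refl
  parity≡0ℙ⇒even (suc (suc n)) p with parity≡0ℙ⇒even n p
  ... | k , refl = suc k , cong suc (sym (ℕₚ.+-suc k k))

  parity≡1ℙ⇒odd : ∀ n → parity n ≡ 1ℙ → ∃[ k ] n ≡ suc (k ℕ.+ k)
  parity≡1ℙ⇒odd (suc zero) _ = 0 , refl
  parity≡1ℙ⇒odd (suc (suc n)) p with parity≡1ℙ⇒odd n p
  ... | k , refl = suc k , cong (suc ∘ suc) (sym (ℕₚ.+-suc k k))

  parityℤ : ℤ → Parity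
  parityℤ z = parity ∣ z ∣

  parityℤ-⊖ : ∀ m n → parityℤ (m ⊖ n) ≡ parity m ℙ.+ parity n
  parityℤ-⊖ m n with m ℕₚ.≤? n
  ... | yes m≤n = trans (cong parity (ℤₚ.∣⊖∣-≤ m≤n)) (trans (parity-∸ m≤n) (ℙₚ.+-comm (parity n) (parity m)))
  ... | no m≰n = trans (cong parity (trans (ℤₚ.∣m⊖n∣≡∣n⊖m∣ m n) (ℤₚ.∣⊖∣-≤ n≤m))) (parity-∸ n≤m)
    where n≤m = ℕₚ.<⇒≤ (ℕₚ.≰⇒> m≰n)

  parityℤ-+ : ∀ x y → parityℤ (x ℤ.+ y) ≡ parityℤ x ℙ.+ parityℤ y
  parityℤ-+ (+ m) (+ n) = ℙₚ.+-homo-+ m n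
  parityℤ-+ (+ m) -[1+ n ] = parityℤ-⊖ m (suc n)
  parityℤ-+ -[1+ m ] (+ n) = trans (parityℤ-⊖ n (suc m)) (ℙₚ.+-comm (parity n) (parity (suc m)))
  parityℤ-+ -[1+ m ] -[1+ n ] = trans (cong (parity ∘ suc) (sym (ℕₚ.+-suc m n))) (ℙₚ.+-homo-+ (suc m) (suc n))

  parityℤ-* : ∀ x y → parityℤ (x ℤ.* y) ≡ parityℤ x ℙ.* parityℤ y
  parityℤ-* x y = trans (cong parity (ℤₚ.abs-* x y)) (ℙₚ.*-homo-* ∣ x ∣ ∣ y ∣)

  parityℤ-neg : ∀ x → parityℤ (- x) ≡ parityℤ x
  parityℤ-neg x = cong parity (ℤₚ.∣-i∣≡∣i∣ x)

  parityℤ≡0ℙ⇒even : ∀ z → parityℤ z ≡ 0ℙ → ∃[ y ] z ≡ y ℤ.+ y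
  parityℤ≡0ℙ⇒even (+ n) p with parity≡0ℙ⇒even n p
  ... | k , refl = + k , sym (ℤₚ.pos-+ k k)
  parityℤ≡0ℙ⇒even -[1+ n ] p with parity≡0ℙ⇒even (suc n) p
  ... | suc k , 1+n≡ = -[1+ k ] , cong -[1+_] (ℕₚ.suc-injective (trans 1+n≡ (cong suc (ℕₚ.+-suc k k))))

  parityℤ≡1ℙ⇒odd : ∀ z → parityℤ z ≡ 1ℙ → ∃[ y ] z ≡ y ℤ.+ y ℤ.+ + 1
  parityℤ≡1ℙ⇒odd (+ n) p with parity≡1ℙ⇒odd n p
  ... | k , refl = + k , trans (cong +_ (ℕₚ.+-comm 1 (k ℕ.+ k)))
                                (trans (ℤₚ.pos-+ (k ℕ.+ k) 1) (cong (ℤ._+ + 1) (ℤₚ.pos-+ k k)))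
  parityℤ≡1ℙ⇒odd -[1+ n ] p with parity≡1ℙ⇒odd (suc n) p
  ... | k , 1+n≡ = -[1+ k ] , cong -[1+_] (ℕₚ.suc-injective 1+n≡)

module ReciprocalOfΨ where

  open import Defs
  open ParitySums
  open PowerSeries
  open IntegerParity
  open import Data.Parity.Base as ℙ using (0ℙ; 1ℙ)
  import Data.Parity.Properties as ℙₚ
  open import Data.Nat as ℕ using (ℕ; zero; suc)
  import Data.Nat.Properties as ℕₚ
  open import Data.Integer as ℤ using (ℤ; -[1+_]; -_)
  open import Data.List using (List; []; _∷_; map; upTo; zipWith; applyUpTo)
  open import Data.List.Properties using (map-upTo; map-applyUpTo)
  open import Function using (_∘_)
  open import Relation.Binary.PropositionalEquality
    using (_≡_; refl; sym; trans; cong; cong₂; _≗_; module ≡-Reasoning)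
  open import Relation.Nullary using (yes; no)

  parityℤ-sumℤ : {A : Set} (xs : List A) (F : A → ℤ) → parityℤ (sumℤ (map F xs)) ≡ ∑ xs (parityℤ ∘ F)
  parityℤ-sumℤ [] F = refl
  parityℤ-sumℤ (x ∷ xs) F = trans (parityℤ-+ (F x) _) (cong (parityℤ (F x) ℙ.+_) (parityℤ-sumℤ xs F))

  parityℤ-sumℤ-zipWith : {A : Set} (xs : List A) (F G : A → ℤ) →
                         parityℤ (sumℤ (zipWith ℤ._*_ (map F xs) (map G xs)))
                         ≡ ∑ xs (λ x → parityℤ (F x) ℙ.* parityℤ (G x))
  parityℤ-sumℤ-zipWith [] F G = refl
  parityℤ-sumℤ-zipWith (x ∷ xs) F G =
    trans (parityℤ-+ (F x ℤ.* G x) _) (cong₂ ℙ._+_ (parityℤ-* (F x) (G x)) (parityℤ-sumℤ-zipWith xs F G))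

  parityℤ-select : ∀ e N v → parityℤ (select e N v) ≡ [ e ℕ.≟ N ] ℙ.* parityℤ v
  parityℤ-select e N v with e ℕ.≟ N
  ... | yes _ = refl
  ... | no _ = refl

  parityℤ-sign : ∀ k → parityℤ (-[1+ 0 ] ℤ.^ k) ≡ 1ℙ
  parityℤ-sign zero = refl
  parityℤ-sign (suc k) = trans (parityℤ-* -[1+ 0 ] (-[1+ 0 ] ℤ.^ k)) (parityℤ-sign k)

  Ψ-mod2 : ℕ → ℕ → Series
  Ψ-mod2 r s j = parityℤ (psiCoeff r s j)

  c-mod2 : ℕ → ℕ → Series
  c-mod2 r s n = parityℤ (c r s n)

  cList≡ : ∀ r s N → cList r s N ≡ map (λ i → c r s (N ℕ.∸ i)) (upTo (suc N))
  cList≡ r s zero = refl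
  cList≡ r s (suc N) = cong (c r s (suc N) ∷_) (begin
    cList r s N                                          ≡⟨ cList≡ r s N ⟩
    map (λ i → c r s (N ℕ.∸ i)) (upTo (suc N))           ≡⟨ map-upTo (λ i → c r s (N ℕ.∸ i)) (suc N) ⟩
    applyUpTo (λ i → c r s (N ℕ.∸ i)) (suc N)            ≡⟨ map-applyUpTo suc (λ i → c r s (suc N ℕ.∸ i)) (suc N) ⟨
    map (λ i → c r s (suc N ℕ.∸ i)) (applyUpTo suc (suc N)) ∎)
    where open ≡-Reasoning

  c-mod2-suc : ∀ r s N → c-mod2 r s (suc N) ≡ ∑ (upTo (suc N)) (λ i → Ψ-mod2 r s (suc i) ℙ.* c-mod2 r s (N ℕ.∸ i))
  c-mod2-suc r s N = begin
    parityℤ (- sumℤ (zipWith ℤ._*_ Ψs (cList r s N)))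
      ≡⟨ parityℤ-neg (sumℤ (zipWith ℤ._*_ Ψs (cList r s N))) ⟩
    parityℤ (sumℤ (zipWith ℤ._*_ Ψs (cList r s N)))
      ≡⟨ cong (parityℤ ∘ sumℤ ∘ zipWith ℤ._*_ Ψs) (cList≡ r s N) ⟩
    parityℤ (sumℤ (zipWith ℤ._*_ Ψs (map (λ i → c r s (N ℕ.∸ i)) (upTo (suc N)))))
      ≡⟨ parityℤ-sumℤ-zipWith (upTo (suc N)) (psiCoeff r s ∘ suc) _ ⟩
    ∑ (upTo (suc N)) (λ i → Ψ-mod2 r s (suc i) ℙ.* c-mod2 r s (N ℕ.∸ i)) ∎
    where
      open ≡-Reasoning
      Ψs = map (psiCoeff r s ∘ suc) (upTo (suc N))

  Ψ-mod2≡ : ∀ r s j → Ψ-mod2 r s j ≡ ∑ (upTo (suc j)) (λ n → [ r ℕ.* tri n ℕ.+ s ℕ.* tri' n ℕ.≟ j ])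
                                 ℙ.+ ∑ (upTo j) (λ k → [ r ℕ.* tri' (suc k) ℕ.+ s ℕ.* tri (suc k) ℕ.≟ j ])
  Ψ-mod2≡ r s j = begin
    parityℤ (sumℤ (map V⁺ (upTo (suc j))) ℤ.+ sumℤ (map V⁻ (map suc (upTo j))))
      ≡⟨ parityℤ-+ (sumℤ (map V⁺ (upTo (suc j)))) _ ⟩
    parityℤ (sumℤ (map V⁺ (upTo (suc j)))) ℙ.+ parityℤ (sumℤ (map V⁻ (map suc (upTo j))))
      ≡⟨ cong₂ ℙ._+_ (parityℤ-sumℤ (upTo (suc j)) V⁺)
                     (trans (parityℤ-sumℤ (map suc (upTo j)) V⁻) (∑-map suc (upTo j) (parityℤ ∘ V⁻))) ⟩
    ∑ (upTo (suc j)) (parityℤ ∘ V⁺) ℙ.+ ∑ (upTo j) (parityℤ ∘ V⁻ ∘ suc)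
      ≡⟨ cong₂ ℙ._+_ (∑-cong (upTo (suc j)) odd⁺) (∑-cong (upTo j) (odd⁻ ∘ suc)) ⟩
    ∑ (upTo (suc j)) (λ n → [ r ℕ.* tri n ℕ.+ s ℕ.* tri' n ℕ.≟ j ])
      ℙ.+ ∑ (upTo j) (λ k → [ r ℕ.* tri' (suc k) ℕ.+ s ℕ.* tri (suc k) ℕ.≟ j ]) ∎
    where
      open ≡-Reasoning
      V⁺ V⁻ : ℕ → ℤ
      V⁺ n = select (r ℕ.* tri n ℕ.+ s ℕ.* tri' n) j (-[1+ 0 ] ℤ.^ tri n)
      V⁻ m = select (r ℕ.* tri' m ℕ.+ s ℕ.* tri m) j (- (-[1+ 0 ] ℤ.^ tri' m))
      odd⁺ : ∀ n → parityℤ (V⁺ n) ≡ [ r ℕ.* tri n ℕ.+ s ℕ.* tri' n ℕ.≟ j ]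
      odd⁺ n = trans (parityℤ-select e j (-[1+ 0 ] ℤ.^ tri n))
                     (trans (cong ([ e ℕ.≟ j ] ℙ.*_) (parityℤ-sign (tri n))) (ℙₚ.*-identityʳ _))
        where e = r ℕ.* tri n ℕ.+ s ℕ.* tri' n
      odd⁻ : ∀ m → parityℤ (V⁻ m) ≡ [ r ℕ.* tri' m ℕ.+ s ℕ.* tri m ℕ.≟ j ]
      odd⁻ m = trans (parityℤ-select e j (- (-[1+ 0 ] ℤ.^ tri' m)))
                     (trans (cong ([ e ℕ.≟ j ] ℙ.*_) (trans (parityℤ-neg (-[1+ 0 ] ℤ.^ tri' m)) (parityℤ-sign (tri' m))))
                            (ℙₚ.*-identityʳ _))
        where e = r ℕ.* tri' m ℕ.+ s ℕ.* tri m

  Ψ-mod2-0 : ∀ r s → Ψ-mod2 r s 0 ≡ 1ℙ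
  Ψ-mod2-0 r s = trans (Ψ-mod2≡ r s 0) (trans (ℙₚ.+-identityʳ _) (trans (ℙₚ.+-identityʳ _)
                   ([]-yes (r ℕ.* 0 ℕ.+ s ℕ.* 0 ℕ.≟ 0) (cong₂ ℕ._+_ (ℕₚ.*-zeroʳ r) (ℕₚ.*-zeroʳ s)))))

  c⊛Ψ≗1 : ∀ r s → c-mod2 r s ⊛ Ψ-mod2 r s ≗ 1ₛ
  c⊛Ψ≗1 r s n = trans (⊛-comm (c-mod2 r s) (Ψ-mod2 r s) n) (Ψ⊛c n)
    where
      Ψ⊛c : ∀ n → (Ψ-mod2 r s ⊛ c-mod2 r s) n ≡ 1ₛ n
      Ψ⊛c zero = trans (ℙₚ.+-identityʳ _) (trans (ℙₚ.*-identityʳ _) (Ψ-mod2-0 r s))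
      Ψ⊛c (suc N) = begin
        (Ψ-mod2 r s ⊛ c-mod2 r s) (suc N)
          ≡⟨ ∑-upTo-head (suc N) (λ i → Ψ-mod2 r s i ℙ.* c-mod2 r s (suc N ℕ.∸ i)) ⟩
        Ψ-mod2 r s 0 ℙ.* c-mod2 r s (suc N) ℙ.+ ∑ (upTo (suc N)) (λ i → Ψ-mod2 r s (suc i) ℙ.* c-mod2 r s (N ℕ.∸ i))
          ≡⟨ cong₂ ℙ._+_ (cong (ℙ._* c-mod2 r s (suc N)) (Ψ-mod2-0 r s)) (sym (c-mod2-suc r s N)) ⟩
        c-mod2 r s (suc N) ℙ.+ c-mod2 r s (suc N)
          ≡⟨ ℙₚ.p+p≡0ℙ (c-mod2 r s (suc N)) ⟩
        0ℙ ∎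
        where open ≡-Reasoning

module ThetaSeries where

  open ParitySums
  open PowerSeries
  open IntegerParity
  open import Data.Parity.Base as ℙ using (Parity; 0ℙ; 1ℙ)
  import Data.Parity.Properties as ℙₚ
  open import Data.Nat as ℕ using (ℕ; zero; suc; _≤_; _<_; z≤n; s≤s; parity)
  import Data.Nat.Properties as ℕₚ
  open import Data.Integer as ℤ using (ℤ; +_; -[1+_]; ∣_∣; -_)
  import Data.Integer.Properties as ℤₚ
  open import Data.List using (List; _++_; map; upTo; cartesianProduct)
  open import Data.List.Membership.Propositional using (_∈_)
  open import Data.List.Membership.Propositional.Properties using (∈-upTo⁻)
  open import Data.Product using (∃-syntax; _×_; _,_; proj₁; proj₂)
  open import Data.Product.Properties using (≡-dec)
  open import Function using (_∘_)
  open import Relation.Binary.PropositionalEquality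
    using (_≡_; _≢_; refl; sym; trans; cong; cong₂; subst; _≗_; module ≡-Reasoning)
  import Data.Sign.Properties as Signₚ
  open import Data.Integer.Tactic.RingSolver using (solve-∀)

  module Sℤ = Sifting ℤ._≟_

  box : ℕ → List ℤ
  box M = map -[1+_] (upTo M) ++ map +_ (upTo (suc M))

  ∑-box : (M : ℕ) (F : ℤ → Parity) → ∑ (box M) F ≡ ∑ (upTo M) (F ∘ -[1+_]) ℙ.+ ∑ (upTo (suc M)) (F ∘ +_)
  ∑-box M F = trans (∑-++ (map -[1+_] (upTo M)) _ F) (cong₂ ℙ._+_ (∑-map -[1+_] (upTo M) F) (∑-map +_ (upTo (suc M)) F))

  mult-box : ∀ {M t} → ∣ t ∣ ≤ M → Sℤ.mult (box M) t ≡ 1ℙ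
  mult-box {M} {+ n} n≤M = trans (∑-box M (λ x → [ x ℤ.≟ + n ])) (cong₂ ℙ._+_ negatives nonnegatives)
    where
      negatives = ∑-zero (upTo M) (λ {k} _ → []-no (-[1+ k ] ℤ.≟ + n) λ ())
      nonnegatives = trans (∑-cong (upTo (suc M)) (λ k → []-⇔ ℤₚ.+-injective (cong +_) (+ k ℤ.≟ + n) (k ℕ.≟ n)))
                           (mult-upTo (s≤s n≤M))
  mult-box {M} { -[1+ n ]} 1+n≤M = trans (∑-box M (λ x → [ x ℤ.≟ -[1+ n ] ])) (cong₂ ℙ._+_ negatives nonnegatives)
    where
      negatives = trans (∑-cong (upTo M) (λ k → []-⇔ ℤₚ.-[1+-injective (cong -[1+_]) (-[1+ k ] ℤ.≟ -[1+ n ]) (k ℕ.≟ n)))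
                        (mult-upTo 1+n≤M)
      nonnegatives = ∑-zero (upTo (suc M)) (λ {k} _ → []-no (+ k ℤ.≟ -[1+ n ]) λ ())

  ∑-box-truncate : ∀ {M M′} (F : ℤ → Parity) → M ≤ M′ → (∀ {t} → F t ≡ 1ℙ → ∣ t ∣ ≤ M) →
                   ∑ (box M′) F ≡ ∑ (box M) F
  ∑-box-truncate {M} {M′} F M≤M′ support = begin
    ∑ (box M′) F
      ≡⟨ ∑-box M′ F ⟩
    ∑ (upTo M′) (F ∘ -[1+_]) ℙ.+ ∑ (upTo (suc M′)) (F ∘ +_)
      ≡⟨ cong₂ ℙ._+_ (∑-upTo-truncate _ M≤M′ negatives)
                       (∑-upTo-truncate _ (s≤s M≤M′) nonnegatives) ⟩
    ∑ (upTo M) (F ∘ -[1+_]) ℙ.+ ∑ (upTo (suc M)) (F ∘ +_)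
      ≡⟨ ∑-box M F ⟨
    ∑ (box M) F ∎
    where
      open ≡-Reasoning
      negatives : ∀ {k} → M ≤ k → F -[1+ k ] ≡ 0ℙ
      negatives M≤k = ≢1ℙ⇒≡0ℙ _ (λ F≡1 → ℕₚ.<⇒≱ (support F≡1) M≤k)
      nonnegatives : ∀ {k} → suc M ≤ k → F (+ k) ≡ 0ℙ
      nonnegatives M<k = ≢1ℙ⇒≡0ℙ _ (λ F≡1 → ℕₚ.<⇒≱ M<k (support F≡1))

  sq : ℤ → ℕ
  sq x = ∣ x ∣ ℕ.* ∣ x ∣

  root : ℕ → ℤ → ℤ
  root a t = + 7 ℤ.* t ℤ.+ + a

  -- θ a is Σ_{t ∈ ℤ} q^{(7t+a)²} over 𝔽₂; only |t| ≤ n can contribute to the coefficient of qⁿ.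
  θ : ℕ → Series
  θ a n = ∑ (box n) (λ t → [ sq (root a t) ℕ.≟ n ])

  ∣root-pos∣ : ∀ a n → ∣ root a (+ n) ∣ ≡ 7 ℕ.* n ℕ.+ a
  ∣root-pos∣ a n = cong (λ x → ∣ x ℤ.+ + a ∣) (ℤₚ.+◃n≡+n (7 ℕ.* n))

  ∣t∣≤∣root∣ : ∀ {a} → a ≤ 6 → ∀ t → ∣ t ∣ ≤ ∣ root a t ∣
  ∣t∣≤∣root∣ {a} a≤6 (+ n) = subst (n ≤_) (sym (∣root-pos∣ a n)) (ℕₚ.≤-trans (ℕₚ.m≤n*m n 7) (ℕₚ.m≤m+n (7 ℕ.* n) a))
  ∣t∣≤∣root∣ {a} a≤6 -[1+ n ] = subst (suc n ≤_) (sym (ℤₚ.∣⊖∣-≤ a≤7+7n)) (ℕₚ.m+n≤o⇒m≤o∸n (suc n) 1+n+a≤7+7n)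
    where
      a≤6+6n = ℕₚ.≤-trans a≤6 (ℕₚ.m≤m*n 6 (suc n))
      1+n+a≤7+7n = ℕₚ.+-monoʳ-≤ (suc n) a≤6+6n
      a≤7+7n = ℕₚ.≤-trans a≤6+6n (ℕₚ.m≤n+m _ (suc n))

  n≤n*n : ∀ n → n ≤ n ℕ.* n
  n≤n*n zero = z≤n
  n≤n*n (suc n) = ℕₚ.m≤m+n (suc n) _

  ∣t∣≤sq-root : ∀ {a} → a ≤ 6 → ∀ t → ∣ t ∣ ≤ sq (root a t)
  ∣t∣≤sq-root a≤6 t = ℕₚ.≤-trans (∣t∣≤∣root∣ a≤6 t) (n≤n*n _)

  ∣t∣≤n : ∀ {a n} → a ≤ 6 → ∀ t → sq (root a t) ≡ n → ∣ t ∣ ≤ n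
  ∣t∣≤n a≤6 t refl = ∣t∣≤sq-root a≤6 t

  θ-box : ∀ {a n M} → a ≤ 6 → n ≤ M → θ a n ≡ ∑ (box M) (λ t → [ sq (root a t) ℕ.≟ n ])
  θ-box {a} {n} a≤6 n≤M = sym (∑-box-truncate (λ t → [ sq (root a t) ℕ.≟ n ]) n≤M
    (λ {t} term≡1 → ∣t∣≤n a≤6 t ([]≡1ℙ⇒ (sq (root a t) ℕ.≟ n) term≡1)))

  θ-square : ∀ a n → θ a n ≡ 1ℙ → ∃[ x ] x ℕ.* x ≡ n
  θ-square a n θ≡1 with ∑-witness (box n) _ θ≡1
  ... | t , _ , term≡1 = ∣ root a t ∣ , []≡1ℙ⇒ (sq (root a t) ℕ.≟ n) term≡1

  θ⊛θ : ∀ {a b} → a ≤ 6 → b ≤ 6 → ∀ n →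
        (θ a ⊛ θ b) n ≡ ∑ (box n) (λ t → ∑ (box n) (λ w → [ sq (root a t) ℕ.+ sq (root b w) ℕ.≟ n ]))
  θ⊛θ {a} {b} a≤6 b≤6 n = begin
    (θ a ⊛ θ b) n
      ≡⟨ ∑-cong-∈ U (λ {i} i∈ → cong₂ ℙ._*_ (θ-box a≤6 (ℕₚ.≤-pred (∈-upTo⁻ i∈))) (θ-box b≤6 (ℕₚ.m∸n≤m n i))) ⟩
    ∑ U (λ i → ∑ B (λ t → [ X t ℕ.≟ i ]) ℙ.* ∑ B (λ w → [ Y w ℕ.≟ n ℕ.∸ i ]))
      ≡⟨ ∑-cong U (λ i → trans (*-distribʳ-∑ _ B (λ t → [ X t ℕ.≟ i ]))
                               (∑-cong B (λ t → *-distribˡ-∑ [ X t ℕ.≟ i ] B _))) ⟩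
    ∑ U (λ i → ∑ B (λ t → ∑ B (λ w → [ X t ℕ.≟ i ] ℙ.* [ Y w ℕ.≟ n ℕ.∸ i ])))
      ≡⟨ ∑-rotate₃ U B B (λ i t w → [ X t ℕ.≟ i ] ℙ.* [ Y w ℕ.≟ n ℕ.∸ i ]) ⟩
    ∑ B (λ t → ∑ B (λ w → ∑ U (λ i → [ X t ℕ.≟ i ] ℙ.* [ Y w ℕ.≟ n ℕ.∸ i ])))
      ≡⟨ ∑-cong B (λ t → ∑-cong B (λ w → ∑-upTo-sift-∸ (X t) (Y w) n)) ⟩
    ∑ B (λ t → ∑ B (λ w → [ X t ℕ.+ Y w ℕ.≟ n ]))
      ∎
    where
      open ≡-Reasoning
      U = upTo (suc n)
      B = box n
      X = sq ∘ root a
      Y = sq ∘ root b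

  +sq : ∀ x → + sq x ≡ x ℤ.* x
  +sq x = trans (sym (ℤₚ.+◃n≡+n (sq x))) (cong (ℤ._◃ sq x) (sym (Signₚ.s*s≡+ (ℤ.sign x))))

  parity-sq-root : ∀ a t → parity (sq (root a t)) ≡ parityℤ t ℙ.+ parity a
  parity-sq-root a t = trans (ℙₚ.*-homo-* ∣ root a t ∣ ∣ root a t ∣)
                             (trans (ℙₚ.*-idem (parityℤ (root a t)))
                             (trans (parityℤ-+ (+ 7 ℤ.* t) (+ a)) (cong (ℙ._+ parity a) (parityℤ-* (+ 7) t))))

  *2-injective : ∀ {m n} → m ℕ.* 2 ≡ n ℕ.* 2 → m ≡ n
  *2-injective {m} {n} = ℕₚ.*-cancelʳ-≡ m n 2

  negOdd : ℤ → ℤ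
  negOdd w = - (w ℤ.+ w ℤ.+ + 1)

  negOdd-injective : ∀ {w w′} → negOdd w ≡ negOdd w′ → w ≡ w′
  negOdd-injective {w} {w′} eq =
    ℤₚ.*-cancelˡ-≡ (+ 2) w w′ (trans (double w) (trans (cong (λ x → - x ℤ.- + 1) eq) (sym (double w′))))
    where
      double : ∀ w → + 2 ℤ.* w ≡ - (- (w ℤ.+ w ℤ.+ + 1)) ℤ.- + 1
      double = solve-∀

  -- 7(-(2w+1)) + 1 = -2(7w + 3).
  sq-root-negOdd : ∀ w → sq (root 1 (negOdd w)) ≡ sq (root 3 w) ℕ.* 2 ℕ.* 2
  sq-root-negOdd w = ℤₚ.+-injective (begin
    + sq (root 1 (negOdd w))                ≡⟨ +sq (root 1 (negOdd w)) ⟩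
    root 1 (negOdd w) ℤ.* root 1 (negOdd w) ≡⟨ identity w ⟩
    root 3 w ℤ.* root 3 w ℤ.* + 2 ℤ.* + 2   ≡⟨ cong (λ x → x ℤ.* + 2 ℤ.* + 2) (+sq (root 3 w)) ⟨
    + sq (root 3 w) ℤ.* + 2 ℤ.* + 2         ≡⟨ cong (ℤ._* + 2) (ℤₚ.pos-* (sq (root 3 w)) 2) ⟨
    + (sq (root 3 w) ℕ.* 2) ℤ.* + 2         ≡⟨ ℤₚ.pos-* (sq (root 3 w) ℕ.* 2) 2 ⟨
    + (sq (root 3 w) ℕ.* 2 ℕ.* 2)           ∎)
    where
      open ≡-Reasoning
      identity : ∀ w → (+ 7 ℤ.* - (w ℤ.+ w ℤ.+ + 1) ℤ.+ + 1) ℤ.* (+ 7 ℤ.* - (w ℤ.+ w ℤ.+ + 1) ℤ.+ + 1) ≡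
                       (+ 7 ℤ.* w ℤ.+ + 3) ℤ.* (+ 7 ℤ.* w ℤ.+ + 3) ℤ.* + 2 ℤ.* + 2
      identity = solve-∀

  sq-root₁-even : ∀ t {m} → sq (root 1 t) ≡ m ℕ.* 2 → ∃[ w ] t ≡ negOdd w × sq (root 3 w) ℕ.* 2 ≡ m
  sq-root₁-even t {m} sq≡m*2 = w , t≡negOdd-w , *2-injective (begin
    sq (root 3 w) ℕ.* 2 ℕ.* 2    ≡⟨ sq-root-negOdd w ⟨
    sq (root 1 (negOdd w))       ≡⟨ cong (sq ∘ root 1) t≡negOdd-w ⟨
    sq (root 1 t)                ≡⟨ sq≡m*2 ⟩
    m ℕ.* 2                      ∎)
    where
      open ≡-Reasoning
      +1ℙ≡0ℙ⇒ : ∀ {p} → p ℙ.+ 1ℙ ≡ 0ℙ → p ≡ 1ℙ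
      +1ℙ≡0ℙ⇒ {1ℙ} _ = refl
      t-odd : parityℤ t ≡ 1ℙ
      t-odd = +1ℙ≡0ℙ⇒ (trans (sym (parity-sq-root 1 t)) (trans (cong parity sq≡m*2) (parity-*2 m)))
      y = proj₁ (parityℤ≡1ℙ⇒odd t t-odd)
      w = - y ℤ.- + 1
      identity : ∀ y → y ℤ.+ y ℤ.+ + 1 ≡ - ((- y ℤ.- + 1) ℤ.+ (- y ℤ.- + 1) ℤ.+ + 1)
      identity = solve-∀
      t≡negOdd-w : t ≡ negOdd w
      t≡negOdd-w = trans (proj₂ (parityℤ≡1ℙ⇒odd t t-odd)) (identity y)

  θ₁-4n : ∀ n → θ 1 (n ℕ.* 2 ℕ.* 2) ≡ θ 3 n
  θ₁-4n n = Sℤ.∑-reindex (box N) (box n) {λ t → [ sq (root 1 t) ℕ.≟ N ]} {λ w → [ sq (root 3 w) ℕ.≟ n ]}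
                         negOdd on-image image-in-box preimage-unique
    where
      N = n ℕ.* 2 ℕ.* 2
      on-image : ∀ {w} → w ∈ box n → [ sq (root 3 w) ℕ.≟ n ] ≡ [ sq (root 1 (negOdd w)) ℕ.≟ N ]
      on-image {w} _ = trans ([]-⇔ (cong (λ m → m ℕ.* 2 ℕ.* 2)) (*2-injective ∘ *2-injective)
                                   (sq (root 3 w) ℕ.≟ n) (sq (root 3 w) ℕ.* 2 ℕ.* 2 ℕ.≟ N))
                             (cong (λ m → [ m ℕ.≟ N ]) (sym (sq-root-negOdd w)))
      image-in-box : ∀ {w} → w ∈ box n → [ sq (root 3 w) ℕ.≟ n ] ≡ 1ℙ → Sℤ.mult (box N) (negOdd w) ≡ 1ℙ
      image-in-box {w} _ term≡1 = mult-box (∣t∣≤n (s≤s z≤n) (negOdd w)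
        (trans (sq-root-negOdd w) (cong (λ m → m ℕ.* 2 ℕ.* 2) ([]≡1ℙ⇒ (sq (root 3 w) ℕ.≟ n) term≡1))))
      preimage-unique : ∀ {t} → t ∈ box N → [ sq (root 1 t) ℕ.≟ N ] ≡ 1ℙ → ∑ (box n) (λ w → [ t ℤ.≟ negOdd w ]) ≡ 1ℙ
      preimage-unique {t} _ term≡1 =
        trans (∑-cong (box n) t≟negOdd-w⇔w≟w₀) (mult-box {n} {w₀} (∣t∣≤n (s≤s (s≤s (s≤s z≤n))) w₀ sq₃≡n))
        where
          solution = sq-root₁-even t {n ℕ.* 2} ([]≡1ℙ⇒ (sq (root 1 t) ℕ.≟ N) term≡1)
          w₀ = proj₁ solution
          t≡₀ = proj₁ (proj₂ solution)
          sq₃≡n = *2-injective (proj₂ (proj₂ solution))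
          t≟negOdd-w⇔w≟w₀ : ∀ w → [ t ℤ.≟ negOdd w ] ≡ [ w ℤ.≟ w₀ ]
          t≟negOdd-w⇔w≟w₀ w = []-⇔ (λ t≡ → negOdd-injective (trans (sym t≡) t≡₀))
                                   (λ w≡w₀ → trans t≡₀ (cong negOdd (sym w≡w₀)))
                                   (t ℤ.≟ negOdd w) (w ℤ.≟ w₀)

  θ₁-4n+2 : ∀ n → θ 1 ((1 ℕ.+ n ℕ.* 2) ℕ.* 2) ≡ 0ℙ
  θ₁-4n+2 n = ∑-zero (box N) (λ {t} _ → []-no (sq (root 1 t) ℕ.≟ N) (no-solution t))
    where
      N = (1 ℕ.+ n ℕ.* 2) ℕ.* 2
      no-solution : ∀ t → sq (root 1 t) ≢ N
      no-solution t eq = ℕₚ.even≢odd (sq (root 3 w)) n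
                           (trans (ℕₚ.*-comm 2 (sq (root 3 w)))
                                  (trans (proj₂ (proj₂ solution)) (cong suc (ℕₚ.*-comm n 2))))
        where
          solution = sq-root₁-even t {1 ℕ.+ n ℕ.* 2} eq
          w = proj₁ solution

  dissect₂-θ₁ : dissect 2 0 (θ 1) ≗ dilate 2 (θ 3)
  dissect₂-θ₁ = dissect-ext 2 by-residue
    where
      by-residue : ∀ {r} → r < 2 → dissect 2 r (dissect 2 0 (θ 1)) ≗ dissect 2 r (dilate 2 (θ 3))
      by-residue {0} _ n = trans (θ₁-4n n) (sym (dilate-* 2 (θ 3) n))
      by-residue {1} _ n = trans (θ₁-4n+2 n) (sym (dissect-dilate 2 (s≤s z≤n) ℕₚ.≤-refl (θ 3) n))
      by-residue {suc (suc _)} (s≤s (s≤s ()))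

  module Sℤ² = Sifting (≡-dec ℤ._≟_ ℤ._≟_)

  diffSum : ℤ × ℤ → ℤ × ℤ
  diffSum (u , v) = u ℤ.- v , u ℤ.+ v

  diffSum-injective : ∀ {p p′} → diffSum p ≡ diffSum p′ → p ≡ p′
  diffSum-injective {u , v} {u′ , v′} eq = cong₂ _,_ u≡u′ (v≡v′ u≡u′)
    where
      twice : ∀ u v → + 2 ℤ.* u ≡ (u ℤ.- v) ℤ.+ (u ℤ.+ v)
      twice = solve-∀
      u≡u′ : u ≡ u′
      u≡u′ = ℤₚ.*-cancelˡ-≡ (+ 2) u u′ (trans (twice u v) (trans (cong (λ (d , s) → d ℤ.+ s) eq) (sym (twice u′ v′))))
      recover : ∀ u v → v ≡ (u ℤ.+ v) ℤ.- u
      recover = solve-∀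
      v≡v′ : u ≡ u′ → v ≡ v′
      v≡v′ refl = trans (recover u v) (trans (cong (ℤ._- u) (cong proj₂ eq)) (sym (recover u v′)))

  -- With X = 7u + 2 and Y = 7v + 1 the two roots are X − Y and X + Y, and (X−Y)² + (X+Y)² = 2(X² + Y²).
  sq-root-diffSum : ∀ u v → sq (root 1 (u ℤ.- v)) ℕ.+ sq (root 3 (u ℤ.+ v)) ≡ (sq (root 2 u) ℕ.+ sq (root 1 v)) ℕ.* 2
  sq-root-diffSum u v = ℤₚ.+-injective (begin
    + (sq (root 1 (u ℤ.- v)) ℕ.+ sq (root 3 (u ℤ.+ v)))
      ≡⟨ ℤₚ.pos-+ (sq (root 1 (u ℤ.- v))) _ ⟩
    + sq (root 1 (u ℤ.- v)) ℤ.+ + sq (root 3 (u ℤ.+ v))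
      ≡⟨ cong₂ ℤ._+_ (+sq (root 1 (u ℤ.- v))) (+sq (root 3 (u ℤ.+ v))) ⟩
    root 1 (u ℤ.- v) ℤ.* root 1 (u ℤ.- v) ℤ.+ root 3 (u ℤ.+ v) ℤ.* root 3 (u ℤ.+ v)
      ≡⟨ identity u v ⟩
    (root 2 u ℤ.* root 2 u ℤ.+ root 1 v ℤ.* root 1 v) ℤ.* + 2
      ≡⟨ cong₂ (λ x y → (x ℤ.+ y) ℤ.* + 2) (+sq (root 2 u)) (+sq (root 1 v)) ⟨
    (+ sq (root 2 u) ℤ.+ + sq (root 1 v)) ℤ.* + 2
      ≡⟨ cong (ℤ._* + 2) (ℤₚ.pos-+ (sq (root 2 u)) _) ⟨
    + (sq (root 2 u) ℕ.+ sq (root 1 v)) ℤ.* + 2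
      ≡⟨ ℤₚ.pos-* (sq (root 2 u) ℕ.+ sq (root 1 v)) 2 ⟨
    + ((sq (root 2 u) ℕ.+ sq (root 1 v)) ℕ.* 2) ∎)
    where
      open ≡-Reasoning
      identity : ∀ u v →
        (+ 7 ℤ.* (u ℤ.- v) ℤ.+ + 1) ℤ.* (+ 7 ℤ.* (u ℤ.- v) ℤ.+ + 1)
          ℤ.+ (+ 7 ℤ.* (u ℤ.+ v) ℤ.+ + 3) ℤ.* (+ 7 ℤ.* (u ℤ.+ v) ℤ.+ + 3)
        ≡ ((+ 7 ℤ.* u ℤ.+ + 2) ℤ.* (+ 7 ℤ.* u ℤ.+ + 2) ℤ.+ (+ 7 ℤ.* v ℤ.+ + 1) ℤ.* (+ 7 ℤ.* v ℤ.+ + 1)) ℤ.* + 2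
      identity = solve-∀

  mult-box² : ∀ {a b n t w} → a ≤ 6 → b ≤ 6 → sq (root a t) ℕ.+ sq (root b w) ≡ n →
              Sℤ².mult (cartesianProduct (box n) (box n)) (t , w) ≡ 1ℙ
  mult-box² {n = n} {t} {w} a≤6 b≤6 sum≡n = trans (mult-cartesianProduct ℤ._≟_ ℤ._≟_ (box n) (box n) t w)
    (cong₂ ℙ._*_ (mult-box (ℕₚ.≤-trans (∣t∣≤sq-root a≤6 t) (ℕₚ.m+n≤o⇒m≤o _ (ℕₚ.≤-reflexive sum≡n))))
                 (mult-box (ℕₚ.≤-trans (∣t∣≤sq-root b≤6 w) (ℕₚ.m+n≤o⇒n≤o _ (ℕₚ.≤-reflexive sum≡n)))))

  sq-root₁₃-even : ∀ t w {m} → sq (root 1 t) ℕ.+ sq (root 3 w) ≡ m ℕ.* 2 →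
                   ∃[ p ] (t , w) ≡ diffSum p × sq (root 2 (proj₁ p)) ℕ.+ sq (root 1 (proj₂ p)) ≡ m
  sq-root₁₃-even t w {m} sum≡m*2 = (y , w ℤ.- y) , t,w≡diffSum , *2-injective (begin
    (sq (root 2 y) ℕ.+ sq (root 1 (w ℤ.- y))) ℕ.* 2
      ≡⟨ sq-root-diffSum y (w ℤ.- y) ⟨
    sq (root 1 (y ℤ.- (w ℤ.- y))) ℕ.+ sq (root 3 (y ℤ.+ (w ℤ.- y)))
      ≡⟨ cong (λ (t′ , w′) → sq (root 1 t′) ℕ.+ sq (root 3 w′)) t,w≡diffSum ⟨
    sq (root 1 t) ℕ.+ sq (root 3 w)
      ≡⟨ sum≡m*2 ⟩
    m ℕ.* 2 ∎)
    where
      open ≡-Reasoning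
      shift : ∀ p p′ → p ℙ.+ p′ ≡ (p ℙ.+ 1ℙ) ℙ.+ (p′ ℙ.+ 1ℙ)
      shift 0ℙ 0ℙ = refl
      shift 0ℙ 1ℙ = refl
      shift 1ℙ 0ℙ = refl
      shift 1ℙ 1ℙ = refl
      t+w-even : parityℤ (t ℤ.+ w) ≡ 0ℙ
      t+w-even = begin
        parityℤ (t ℤ.+ w)                                     ≡⟨ parityℤ-+ t w ⟩
        parityℤ t ℙ.+ parityℤ w                               ≡⟨ shift (parityℤ t) (parityℤ w) ⟩
        (parityℤ t ℙ.+ 1ℙ) ℙ.+ (parityℤ w ℙ.+ 1ℙ)             ≡⟨ cong₂ ℙ._+_ (parity-sq-root 1 t) (parity-sq-root 3 w) ⟨
        parity (sq (root 1 t)) ℙ.+ parity (sq (root 3 w))     ≡⟨ ℙₚ.+-homo-+ (sq (root 1 t)) (sq (root 3 w)) ⟨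
        parity (sq (root 1 t) ℕ.+ sq (root 3 w))              ≡⟨ cong parity sum≡m*2 ⟩
        parity (m ℕ.* 2)                                      ≡⟨ parity-*2 m ⟩
        0ℙ                                                    ∎
      y = proj₁ (parityℤ≡0ℙ⇒even (t ℤ.+ w) t+w-even)
      left : ∀ t w y → t ℤ.+ w ≡ y ℤ.+ y → t ≡ y ℤ.- (w ℤ.- y)
      left t w y t+w≡2y = trans (t≡[t+w]-w t w) (trans (cong (ℤ._- w) t+w≡2y) (2y-w≡y-[w-y] y w))
        where
          t≡[t+w]-w : ∀ t w → t ≡ (t ℤ.+ w) ℤ.- w
          t≡[t+w]-w = solve-∀
          2y-w≡y-[w-y] : ∀ y w → (y ℤ.+ y) ℤ.- w ≡ y ℤ.- (w ℤ.- y)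
          2y-w≡y-[w-y] = solve-∀
      right : ∀ y w → w ≡ y ℤ.+ (w ℤ.- y)
      right = solve-∀
      t,w≡diffSum : (t , w) ≡ diffSum (y , w ℤ.- y)
      t,w≡diffSum = cong₂ _,_ (left t w y (proj₂ (parityℤ≡0ℙ⇒even (t ℤ.+ w) t+w-even))) (right y w)

  dissect₂-θ₁⊛θ₃ : dissect 2 0 (θ 1 ⊛ θ 3) ≗ θ 2 ⊛ θ 1
  dissect₂-θ₁⊛θ₃ n = begin
    (θ 1 ⊛ θ 3) (n ℕ.* 2)                    ≡⟨ θ⊛θ 1≤6 3≤6 (n ℕ.* 2) ⟩
    ∑ B₂ (λ t → ∑ B₂ (λ w → f (t , w)))      ≡⟨ ∑-cartesianProduct B₂ B₂ f ⟨
    ∑ (cartesianProduct B₂ B₂) f             ≡⟨ Sℤ².∑-reindex (cartesianProduct B₂ B₂) (cartesianProduct B B) diffSum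
                                                               on-image image-in-box preimage-unique ⟩
    ∑ (cartesianProduct B B) g               ≡⟨ ∑-cartesianProduct B B g ⟩
    ∑ B (λ u → ∑ B (λ v → g (u , v)))        ≡⟨ θ⊛θ 2≤6 1≤6 n ⟨
    (θ 2 ⊛ θ 1) n                            ∎
    where
      open ≡-Reasoning
      1≤6 = s≤s z≤n
      2≤6 = s≤s (s≤s z≤n)
      3≤6 = s≤s (s≤s (s≤s z≤n))
      B = box n
      B₂ = box (n ℕ.* 2)
      f g : ℤ × ℤ → Parity
      f (t , w) = [ sq (root 1 t) ℕ.+ sq (root 3 w) ℕ.≟ n ℕ.* 2 ]
      g (u , v) = [ sq (root 2 u) ℕ.+ sq (root 1 v) ℕ.≟ n ]
      on-image : ∀ {p} → p ∈ cartesianProduct B B → g p ≡ f (diffSum p)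
      on-image {u , v} _ = trans ([]-⇔ (cong (ℕ._* 2)) *2-injective (S ℕ.≟ n) (S ℕ.* 2 ℕ.≟ n ℕ.* 2))
                                 (cong (λ m → [ m ℕ.≟ n ℕ.* 2 ]) (sym (sq-root-diffSum u v)))
        where S = sq (root 2 u) ℕ.+ sq (root 1 v)
      image-in-box : ∀ {p} → p ∈ cartesianProduct B B → g p ≡ 1ℙ → Sℤ².mult (cartesianProduct B₂ B₂) (diffSum p) ≡ 1ℙ
      image-in-box {u , v} _ g≡1 = mult-box² 1≤6 3≤6
        (trans (sq-root-diffSum u v) (cong (ℕ._* 2) ([]≡1ℙ⇒ (sq (root 2 u) ℕ.+ sq (root 1 v) ℕ.≟ n) g≡1)))
      preimage-unique : ∀ {x} → x ∈ cartesianProduct B₂ B₂ → f x ≡ 1ℙ →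
                        ∑ (cartesianProduct B B) (λ p → [ ≡-dec ℤ._≟_ ℤ._≟_ x (diffSum p) ]) ≡ 1ℙ
      preimage-unique {t , w} _ f≡1 = trans (∑-cong (cartesianProduct B B) x≟diffSum-p⇔p≟p₀) (mult-box² 2≤6 1≤6 sum₀≡n)
        where
          solution = sq-root₁₃-even t w {n} ([]≡1ℙ⇒ (sq (root 1 t) ℕ.+ sq (root 3 w) ℕ.≟ n ℕ.* 2) f≡1)
          p₀ = proj₁ solution
          x≡ = proj₁ (proj₂ solution)
          sum₀≡n = proj₂ (proj₂ solution)
          x≟diffSum-p⇔p≟p₀ : ∀ p → [ ≡-dec ℤ._≟_ ℤ._≟_ (t , w) (diffSum p) ] ≡ [ ≡-dec ℤ._≟_ ℤ._≟_ p p₀ ]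
          x≟diffSum-p⇔p≟p₀ p = []-⇔ (λ x≡diffSum-p → diffSum-injective (trans (sym x≡diffSum-p) x≡))
                                    (λ p≡p₀ → trans x≡ (cong diffSum (sym p≡p₀)))
                                    (≡-dec ℤ._≟_ ℤ._≟_ (t , w) (diffSum p)) (≡-dec ℤ._≟_ ℤ._≟_ p p₀)

  θ₁⁷ : Series
  θ₁⁷ = θ 1 ⊛ dilate 2 (θ 1 ⊛ dilate 2 (θ 1))

  θ₁⊛θ₁⁷ : θ 1 ⊛ θ₁⁷ ≗ dilate 2 (dilate 2 (dilate 2 (θ 1)))
  θ₁⊛θ₁⁷ = begin
    θ 1 ⊛ (θ 1 ⊛ dilate 2 (θ 1 ⊛ dilate 2 (θ 1)))   ≈⟨ ⊛-self-⊛-dilate (θ 1) (θ 1 ⊛ dilate 2 (θ 1)) ⟩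
    dilate 2 (θ 1 ⊛ (θ 1 ⊛ dilate 2 (θ 1)))         ≈⟨ dilate-cong 2 (⊛-self-⊛-dilate (θ 1) (θ 1)) ⟩
    dilate 2 (dilate 2 (θ 1 ⊛ θ 1))                 ≈⟨ dilate-cong 2 (dilate-cong 2 (⊛-self (θ 1))) ⟩
    dilate 2 (dilate 2 (dilate 2 (θ 1)))            ∎
    where open ≗-Reasoning

  dissect₂-θ₁⊛dilate : (g : Series) → dissect 2 0 (θ 1 ⊛ dilate 2 g) ≗ g ⊛ dilate 2 (θ 3)
  dissect₂-θ₁⊛dilate g = begin
    dissect 2 0 (θ 1 ⊛ dilate 2 g)   ≈⟨ dissect-cong 2 0 (⊛-comm (θ 1) (dilate 2 g)) ⟩
    dissect 2 0 (dilate 2 g ⊛ θ 1)   ≈⟨ dissect-dilate-⊛ 2 (s≤s z≤n) g (θ 1) ⟩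
    g ⊛ dissect 2 0 (θ 1)            ≈⟨ ⊛-congˡ g dissect₂-θ₁ ⟩
    g ⊛ dilate 2 (θ 3)               ∎
    where open ≗-Reasoning

  dissect₂³-θ₁⁷ : dissect 2 0 (dissect 2 0 (dissect 2 0 θ₁⁷)) ≗ θ 3 ⊛ (θ 2 ⊛ θ 1)
  dissect₂³-θ₁⁷ = begin
    E (E (E θ₁⁷))
      ≈⟨ E-cong (E-cong (dissect₂-θ₁⊛dilate (θ 1 ⊛ dilate 2 (θ 1)))) ⟩
    E (E ((θ 1 ⊛ dilate 2 (θ 1)) ⊛ dilate 2 (θ 3)))
      ≈⟨ E-cong (E-cong (⊛-assoc (θ 1) (dilate 2 (θ 1)) (dilate 2 (θ 3)))) ⟩
    E (E (θ 1 ⊛ (dilate 2 (θ 1) ⊛ dilate 2 (θ 3))))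
      ≈⟨ E-cong (E-cong (⊛-congˡ (θ 1) (dilate-⊛ (θ 1) (θ 3)))) ⟨
    E (E (θ 1 ⊛ dilate 2 (θ 1 ⊛ θ 3)))
      ≈⟨ E-cong (dissect₂-θ₁⊛dilate (θ 1 ⊛ θ 3)) ⟩
    E ((θ 1 ⊛ θ 3) ⊛ dilate 2 (θ 3))
      ≈⟨ E-cong (⊛-comm (θ 1 ⊛ θ 3) (dilate 2 (θ 3))) ⟩
    E (dilate 2 (θ 3) ⊛ (θ 1 ⊛ θ 3))
      ≈⟨ dissect-dilate-⊛ 2 (s≤s z≤n) (θ 3) (θ 1 ⊛ θ 3) ⟩
    θ 3 ⊛ E (θ 1 ⊛ θ 3)
      ≈⟨ ⊛-congˡ (θ 3) dissect₂-θ₁⊛θ₃ ⟩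
    θ 3 ⊛ (θ 2 ⊛ θ 1) ∎
    where
      open ≗-Reasoning
      E = dissect 2 0
      E-cong = dissect-cong 2 0

  θ⊛θ≡1ℙ⇒sum-of-squares : ∀ a b L → (θ a ⊛ θ b) L ≡ 1ℙ → ∃[ x ] ∃[ y ] x ℕ.* x ℕ.+ y ℕ.* y ≡ L
  θ⊛θ≡1ℙ⇒sum-of-squares a b L ⊛≡1 with ∑-witness _ (λ i → θ a i ℙ.* θ b (L ℕ.∸ i)) ⊛≡1
  ... | i , i∈ , term≡1 with θ-square a i (*≡1ℙ⇒ˡ _ _ term≡1) | θ-square b (L ℕ.∸ i) (*≡1ℙ⇒ʳ _ _ term≡1)
  ...   | x , x²≡i | y , y²≡L∸i = x , y , trans (cong₂ ℕ._+_ x²≡i y²≡L∸i) (ℕₚ.m+[n∸m]≡n (ℕₚ.≤-pred (∈-upTo⁻ i∈)))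

module ΨAsTheta where

  open import Defs
  open ParitySums
  open PowerSeries
  open ThetaSeries
  open ReciprocalOfΨ
  open import Data.Parity.Base as ℙ using (Parity; 0ℙ; 1ℙ)
  import Data.Parity.Properties as ℙₚ
  open import Data.Nat as ℕ using (ℕ; zero; suc; _≤_; _<_; z≤n; s≤s)
  import Data.Nat.Properties as ℕₚ
  open import Data.Nat.DivMod using (_%_; [m+kn]%n≡m%n; m<n⇒m%n≡m; m*n/n≡m)
  import Data.Nat.Tactic.RingSolver as ℕS
  open import Data.Integer as ℤ using (ℤ; +_; -[1+_]; ∣_∣)
  import Data.Integer.Properties as ℤₚ
  open import Data.List using (upTo)
  open import Data.Product using (∃-syntax; _×_; _,_; proj₁; proj₂)
  open import Function using (_∘_)
  open import Relation.Binary.PropositionalEquality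
    using (_≡_; refl; sym; trans; cong; cong₂; subst; _≗_; module ≡-Reasoning)
  open import Relation.Nullary using (yes; no)

  triangle : ℕ → ℕ
  triangle zero = 0
  triangle (suc n) = suc n ℕ.+ triangle n

  n[n+1]≡triangle*2 : ∀ n → n ℕ.* suc n ≡ triangle n ℕ.* 2
  n[n+1]≡triangle*2 zero = refl
  n[n+1]≡triangle*2 (suc n) = begin
    suc n ℕ.* suc (suc n)              ≡⟨ expand n ⟩
    suc n ℕ.* 2 ℕ.+ n ℕ.* suc n        ≡⟨ cong (suc n ℕ.* 2 ℕ.+_) (n[n+1]≡triangle*2 n) ⟩
    suc n ℕ.* 2 ℕ.+ triangle n ℕ.* 2   ≡⟨ ℕₚ.*-distribʳ-+ 2 (suc n) (triangle n) ⟨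
    triangle (suc n) ℕ.* 2             ∎
    where
      open ≡-Reasoning
      expand : ∀ n → suc n ℕ.* suc (suc n) ≡ suc n ℕ.* 2 ℕ.+ n ℕ.* suc n
      expand = ℕS.solve-∀

  tri≡triangle : ∀ n → tri n ≡ triangle n
  tri≡triangle n = trans (cong (ℕ._/ 2) (n[n+1]≡triangle*2 n)) (m*n/n≡m (triangle n) 2)

  tri'≡triangle : ∀ n → tri' (suc n) ≡ triangle n
  tri'≡triangle n = trans (cong (ℕ._/ 2) (ℕₚ.*-comm (suc n) n)) (tri≡triangle n)

  n≤tri : ∀ n → n ≤ tri n
  n≤tri n = subst (n ≤_) (sym (tri≡triangle n)) (n≤triangle n)
    where
      n≤triangle : ∀ n → n ≤ triangle n
      n≤triangle zero = z≤n
      n≤triangle (suc n) = ℕₚ.m≤m+n (suc n) (triangle n)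

  -- The exponents of Ψ(-q⁹, q⁵) are the (x² - 1)/7 with x ≡ ±1 (mod 7).
  sq-root₁-pos : ∀ n → sq (root 1 (+ n)) ≡ 1 ℕ.+ (9 ℕ.* tri n ℕ.+ 5 ℕ.* tri' n) ℕ.* 7
  sq-root₁-pos zero = refl
  sq-root₁-pos (suc m) = begin
    sq (root 1 (+ suc m))
      ≡⟨ cong (λ x → x ℕ.* x) (∣root-pos∣ 1 (suc m)) ⟩
    (7 ℕ.* suc m ℕ.+ 1) ℕ.* (7 ℕ.* suc m ℕ.+ 1)
      ≡⟨ expand m ⟩
    64 ℕ.+ 63 ℕ.* m ℕ.+ 49 ℕ.* (m ℕ.* suc m)
      ≡⟨ cong (λ x → 64 ℕ.+ 63 ℕ.* m ℕ.+ 49 ℕ.* x) (n[n+1]≡triangle*2 m) ⟩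
    64 ℕ.+ 63 ℕ.* m ℕ.+ 49 ℕ.* (triangle m ℕ.* 2)
      ≡⟨ regroup m (triangle m) ⟩
    1 ℕ.+ (9 ℕ.* triangle (suc m) ℕ.+ 5 ℕ.* triangle m) ℕ.* 7
      ≡⟨ cong₂ (λ x y → 1 ℕ.+ (9 ℕ.* x ℕ.+ 5 ℕ.* y) ℕ.* 7)
                 (tri≡triangle (suc m)) (tri'≡triangle m) ⟨
    1 ℕ.+ (9 ℕ.* tri (suc m) ℕ.+ 5 ℕ.* tri' (suc m)) ℕ.* 7 ∎
    where
      open ≡-Reasoning
      expand : ∀ m → (7 ℕ.* suc m ℕ.+ 1) ℕ.* (7 ℕ.* suc m ℕ.+ 1) ≡ 64 ℕ.+ 63 ℕ.* m ℕ.+ 49 ℕ.* (m ℕ.* suc m)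
      expand = ℕS.solve-∀
      regroup : ∀ m t → 64 ℕ.+ 63 ℕ.* m ℕ.+ 49 ℕ.* (t ℕ.* 2) ≡ 1 ℕ.+ (9 ℕ.* (suc m ℕ.+ t) ℕ.+ 5 ℕ.* t) ℕ.* 7
      regroup = ℕS.solve-∀

  sq-root₁-neg : ∀ k → sq (root 1 -[1+ k ]) ≡ 1 ℕ.+ (9 ℕ.* tri' (suc k) ℕ.+ 5 ℕ.* tri (suc k)) ℕ.* 7
  sq-root₁-neg k = begin
    sq (root 1 -[1+ k ])
      ≡⟨ cong (λ x → x ℕ.* x) (ℤₚ.∣⊖∣-≤ {1} {7 ℕ.* suc k} (s≤s z≤n)) ⟩
    (k ℕ.+ 6 ℕ.* suc k) ℕ.* (k ℕ.+ 6 ℕ.* suc k)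
      ≡⟨ expand k ⟩
    36 ℕ.+ 35 ℕ.* k ℕ.+ 49 ℕ.* (k ℕ.* suc k)
      ≡⟨ cong (λ x → 36 ℕ.+ 35 ℕ.* k ℕ.+ 49 ℕ.* x) (n[n+1]≡triangle*2 k) ⟩
    36 ℕ.+ 35 ℕ.* k ℕ.+ 49 ℕ.* (triangle k ℕ.* 2)
      ≡⟨ regroup k (triangle k) ⟩
    1 ℕ.+ (9 ℕ.* triangle k ℕ.+ 5 ℕ.* triangle (suc k)) ℕ.* 7
      ≡⟨ cong₂ (λ x y → 1 ℕ.+ (9 ℕ.* x ℕ.+ 5 ℕ.* y) ℕ.* 7)
                 (tri'≡triangle k) (tri≡triangle (suc k)) ⟨
    1 ℕ.+ (9 ℕ.* tri' (suc k) ℕ.+ 5 ℕ.* tri (suc k)) ℕ.* 7 ∎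
    where
      open ≡-Reasoning
      expand : ∀ k → (k ℕ.+ 6 ℕ.* suc k) ℕ.* (k ℕ.+ 6 ℕ.* suc k) ≡ 36 ℕ.+ 35 ℕ.* k ℕ.+ 49 ℕ.* (k ℕ.* suc k)
      expand = ℕS.solve-∀
      regroup : ∀ k t → 36 ℕ.+ 35 ℕ.* k ℕ.+ 49 ℕ.* (t ℕ.* 2) ≡ 1 ℕ.+ (9 ℕ.* t ℕ.+ 5 ℕ.* (suc k ℕ.+ t)) ℕ.* 7
      regroup = ℕS.solve-∀

  sq-root₁-form : ∀ t → ∃[ e ] sq (root 1 t) ≡ 1 ℕ.+ e ℕ.* 7 × ∣ t ∣ ≤ e
  sq-root₁-form (+ n) = 9 ℕ.* tri n ℕ.+ 5 ℕ.* tri' n , sq-root₁-pos n ,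
    ℕₚ.≤-trans (n≤tri n) (ℕₚ.≤-trans (ℕₚ.m≤n*m (tri n) 9) (ℕₚ.m≤m+n (9 ℕ.* tri n) (5 ℕ.* tri' n)))
  sq-root₁-form -[1+ k ] = 9 ℕ.* tri' (suc k) ℕ.+ 5 ℕ.* tri (suc k) , sq-root₁-neg k ,
    ℕₚ.≤-trans (n≤tri (suc k))
               (ℕₚ.≤-trans (ℕₚ.m≤n*m (tri (suc k)) 5) (ℕₚ.m≤n+m (5 ℕ.* tri (suc k)) (9 ℕ.* tri' (suc k))))

  1+*7-injective : ∀ {m n} → 1 ℕ.+ m ℕ.* 7 ≡ 1 ℕ.+ n ℕ.* 7 → m ≡ n
  1+*7-injective {m} {n} eq = ℕₚ.*-cancelʳ-≡ m n 7 (ℕₚ.suc-injective eq)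

  θ₁-support : ∀ m → θ 1 m ≡ 1ℙ → m % 7 ≡ 1
  θ₁-support m θ≡1 with ∑-witness (box m) (λ t → [ sq (root 1 t) ℕ.≟ m ]) θ≡1
  ... | t , _ , term≡1 = begin
    m % 7                   ≡⟨ cong (_% 7) ([]≡1ℙ⇒ (sq (root 1 t) ℕ.≟ m) term≡1) ⟨
    sq (root 1 t) % 7       ≡⟨ cong (_% 7) (proj₁ (proj₂ (sq-root₁-form t))) ⟩
    (1 ℕ.+ e ℕ.* 7) % 7     ≡⟨ [m+kn]%n≡m%n 1 e 7 ⟩
    1                       ∎
    where
      open ≡-Reasoning
      e = proj₁ (sq-root₁-form t)

  dissect₇-θ₁ : dissect 7 1 (θ 1) ≗ Ψ-mod2 9 5
  dissect₇-θ₁ j = begin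
    θ 1 (1 ℕ.+ j ℕ.* 7)
      ≡⟨ ∑-box-truncate {j} {1 ℕ.+ j ℕ.* 7} F (ℕₚ.≤-trans (ℕₚ.m≤m*n j 7) (ℕₚ.m≤n+m (j ℕ.* 7) 1)) (λ {t} → below-j {t}) ⟩
    ∑ (box j) F
      ≡⟨ ∑-box j F ⟩
    ∑ (upTo j) (F ∘ -[1+_]) ℙ.+ ∑ (upTo (suc j)) (F ∘ +_)
      ≡⟨ ℙₚ.+-comm (∑ (upTo j) (F ∘ -[1+_])) _ ⟩
    ∑ (upTo (suc j)) (F ∘ +_) ℙ.+ ∑ (upTo j) (F ∘ -[1+_])
      ≡⟨ cong₂ ℙ._+_ (∑-cong (upTo (suc j)) at-pos) (∑-cong (upTo j) at-neg) ⟩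
    ∑ (upTo (suc j)) (λ n → [ 9 ℕ.* tri n ℕ.+ 5 ℕ.* tri' n ℕ.≟ j ])
      ℙ.+ ∑ (upTo j) (λ k → [ 9 ℕ.* tri' (suc k) ℕ.+ 5 ℕ.* tri (suc k) ℕ.≟ j ])
      ≡⟨ Ψ-mod2≡ 9 5 j ⟨
    Ψ-mod2 9 5 j ∎
    where
      open ≡-Reasoning
      F : ℤ → Parity
      F t = [ sq (root 1 t) ℕ.≟ 1 ℕ.+ j ℕ.* 7 ]
      exponent : ∀ {x e} → x ≡ 1 ℕ.+ e ℕ.* 7 → [ x ℕ.≟ 1 ℕ.+ j ℕ.* 7 ] ≡ [ e ℕ.≟ j ]
      exponent {x} {e} refl = []-⇔ 1+*7-injective (cong (λ m → 1 ℕ.+ m ℕ.* 7)) (x ℕ.≟ 1 ℕ.+ j ℕ.* 7) (e ℕ.≟ j)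
      at-pos : ∀ n → F (+ n) ≡ [ 9 ℕ.* tri n ℕ.+ 5 ℕ.* tri' n ℕ.≟ j ]
      at-pos n = exponent (sq-root₁-pos n)
      at-neg : ∀ k → F -[1+ k ] ≡ [ 9 ℕ.* tri' (suc k) ℕ.+ 5 ℕ.* tri (suc k) ℕ.≟ j ]
      at-neg k = exponent (sq-root₁-neg k)
      below-j : ∀ {t} → F t ≡ 1ℙ → ∣ t ∣ ≤ j
      below-j {t} Ft≡1 with sq-root₁-form t
      ... | e , sq≡ , ∣t∣≤e =
        ℕₚ.≤-trans ∣t∣≤e (ℕₚ.≤-reflexive (1+*7-injective (trans (sym sq≡) ([]≡1ℙ⇒ (_ ℕ.≟ 1 ℕ.+ j ℕ.* 7) Ft≡1))))

  dilate₇c⊛θ₁≗q : dilate 7 (c-mod2 9 5) ⊛ θ 1 ≗ q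
  dilate₇c⊛θ₁≗q = dissect-ext 7 by-residue
    where
      γ = c-mod2 9 5
      by-residue : ∀ {r} → r < 7 → dissect 7 r (dilate 7 γ ⊛ θ 1) ≗ dissect 7 r q
      by-residue {r} r<7 n with r ℕ.≟ 1
      ... | yes refl = begin
        dissect 7 1 (dilate 7 γ ⊛ θ 1) n
          ≡⟨ dissect-dilate-⊛ 7 r<7 γ (θ 1) n ⟩
        (γ ⊛ dissect 7 1 (θ 1)) n
          ≡⟨ ⊛-congˡ γ dissect₇-θ₁ n ⟩
        (γ ⊛ Ψ-mod2 9 5) n
          ≡⟨ c⊛Ψ≗1 9 5 n ⟩
        [ n ℕ.≟ 0 ]
          ≡⟨ []-⇔ (cong (λ m → 1 ℕ.+ m ℕ.* 7)) (λ eq → ℕₚ.m*n≡0⇒m≡0 n 7 (ℕₚ.suc-injective eq))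
                  (n ℕ.≟ 0) (1 ℕ.+ n ℕ.* 7 ℕ.≟ 1) ⟩
        q (1 ℕ.+ n ℕ.* 7) ∎
        where open ≡-Reasoning
      ... | no r≢1 = begin
        dissect 7 r (dilate 7 γ ⊛ θ 1) n   ≡⟨ dissect-dilate-⊛ 7 r<7 γ (θ 1) n ⟩
        (γ ⊛ dissect 7 r (θ 1)) n          ≡⟨ ⊛-congˡ γ off-residue n ⟩
        (γ ⊛ 0ₛ) n                         ≡⟨ ⊛-zeroʳ γ n ⟩
        0ℙ                                 ≡⟨ []-no (r ℕ.+ n ℕ.* 7 ℕ.≟ 1) (r≢1 ∘ residue {n} ∘ cong (_% 7)) ⟨
        q (r ℕ.+ n ℕ.* 7)                  ∎
        where
          open ≡-Reasoning
          residue : ∀ {m} → (r ℕ.+ m ℕ.* 7) % 7 ≡ 1 → r ≡ 1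
          residue {m} eq = trans (sym (m<n⇒m%n≡m r<7)) (trans (sym ([m+kn]%n≡m%n r m 7)) eq)
          off-residue : dissect 7 r (θ 1) ≗ 0ₛ
          off-residue m = ≢1ℙ⇒≡0ℙ (θ 1 (r ℕ.+ m ℕ.* 7)) (r≢1 ∘ residue {m} ∘ θ₁-support (r ℕ.+ m ℕ.* 7))

module SumsOfTwoSquares where

  open import Data.Nat
  open import Data.Nat.Properties
  open import Data.Nat.DivMod
  open import Data.Nat.Divisibility using (divides)
  open import Data.Product using (_×_; _,_; proj₁; proj₂)
  open import Relation.Binary.PropositionalEquality
  open import Relation.Nullary.Decidable using (from-yes; ¬?; _×-dec_; _→-dec_)
  import Data.Nat.Tactic.RingSolver as ℕS

  sum-of-squares-% : ∀ d .{{_ : NonZero d}} x y → (x * x + y * y) % d ≡ ((x % d) * (x % d) + (y % d) * (y % d)) % d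
  sum-of-squares-% d x y = begin
    (x * x + y * y) % d
      ≡⟨ %-distribˡ-+ (x * x) (y * y) d ⟩
    ((x * x) % d + (y * y) % d) % d
      ≡⟨ cong₂ (λ u v → (u + v) % d) (%-distribˡ-* x x d) (%-distribˡ-* y y d) ⟩
    (((x % d) * (x % d)) % d + ((y % d) * (y % d)) % d) % d
      ≡⟨ %-distribˡ-+ ((x % d) * (x % d)) _ d ⟨
    ((x % d) * (x % d) + (y % d) * (y % d)) % d ∎
    where open ≡-Reasoning

  -- Each of the next three facts only depends on x and y modulo 8 (resp. 4) and is decided on all residues.
  sum-of-squares-%4≢3 : ∀ x y → (x * x + y * y) % 4 ≢ 3
  sum-of-squares-%4≢3 x y = subst (_≢ 3) (sym (sum-of-squares-% 4 x y)) (residues (m%n<n x 4) (m%n<n y 4))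
    where
      residues : ∀ {r} → r < 4 → ∀ {s} → s < 4 → (r * r + s * s) % 4 ≢ 3
      residues = from-yes (allUpTo? (λ r → allUpTo? (λ s → ¬? ((r * r + s * s) % 4 ≟ 3)) 4) 4)

  sum-of-squares-%8≢6 : ∀ x y → (x * x + y * y) % 8 ≢ 6
  sum-of-squares-%8≢6 x y = subst (_≢ 6) (sym (sum-of-squares-% 8 x y)) (residues (m%n<n x 8) (m%n<n y 8))
    where
      residues : ∀ {r} → r < 8 → ∀ {s} → s < 8 → (r * r + s * s) % 8 ≢ 6
      residues = from-yes (allUpTo? (λ r → allUpTo? (λ s → ¬? ((r * r + s * s) % 8 ≟ 6)) 8) 8)

  sum-of-squares-%4≡0 : ∀ x y → (x * x + y * y) % 4 ≡ 0 → x % 2 ≡ 0 × y % 2 ≡ 0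
  sum-of-squares-%4≡0 x y %4≡0 with residues (m%n<n x 4) (m%n<n y 4) (trans (sym (sum-of-squares-% 4 x y)) %4≡0)
    where
      residues : ∀ {r} → r < 4 → ∀ {s} → s < 4 → (r * r + s * s) % 4 ≡ 0 → r % 2 ≡ 0 × s % 2 ≡ 0
      residues = from-yes (allUpTo? (λ r → allUpTo? (λ s →
                   ((r * r + s * s) % 4 ≟ 0) →-dec ((r % 2 ≟ 0) ×-dec (s % 2 ≟ 0))) 4) 4)
  ... | x%4%2≡0 , y%4%2≡0 = trans (sym (m∣n⇒o%n%m≡o%m 2 4 x (divides 2 refl))) x%4%2≡0
                          , trans (sym (m∣n⇒o%n%m≡o%m 2 4 y (divides 2 refl))) y%4%2≡0

  even⇒half : ∀ {x} → x % 2 ≡ 0 → x ≡ x / 2 * 2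
  even⇒half {x} x%2≡0 = trans (m≡m%n+[m/n]*n x 2) (cong (_+ x / 2 * 2) x%2≡0)

  sum-of-squares≢2^i*m : ∀ i {m} → m % 4 ≡ 3 → ∀ x y → x * x + y * y ≢ 2 ^ i * m
  sum-of-squares≢2^i*m zero {m} m%4≡3 x y eq =
    sum-of-squares-%4≢3 x y (trans (cong (_% 4) (trans eq (*-identityˡ m))) m%4≡3)
  sum-of-squares≢2^i*m (suc zero) {m} m%4≡3 x y eq = sum-of-squares-%8≢6 x y (begin
    (x * x + y * y) % 8        ≡⟨ cong (_% 8) eq ⟩
    (2 * m) % 8                ≡⟨ cong (λ k → (2 * k) % 8) (trans (m≡m%n+[m/n]*n m 4) (cong (_+ m / 4 * 4) m%4≡3)) ⟩
    (2 * (3 + m / 4 * 4)) % 8  ≡⟨ cong (_% 8) (double (m / 4)) ⟩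
    (6 + m / 4 * 8) % 8        ≡⟨ [m+kn]%n≡m%n 6 (m / 4) 8 ⟩
    6                          ∎)
    where
      open ≡-Reasoning
      double : ∀ q → 2 * (3 + q * 4) ≡ 6 + q * 8
      double = ℕS.solve-∀
  sum-of-squares≢2^i*m (suc (suc i)) {m} m%4≡3 x y eq =
    sum-of-squares≢2^i*m i m%4≡3 (x / 2) (y / 2) (*-cancelʳ-≡ _ _ 4 (begin
      (x / 2 * (x / 2) + y / 2 * (y / 2)) * 4
        ≡⟨ quadruple (x / 2) (y / 2) ⟩
      x / 2 * 2 * (x / 2 * 2) + y / 2 * 2 * (y / 2 * 2)
        ≡⟨ cong₂ (λ u v → u * u + v * v) (even⇒half {x} x-even) (even⇒half {y} y-even) ⟨
      x * x + y * y
        ≡⟨ eq ⟩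
      2 * (2 * 2 ^ i) * m
        ≡⟨ regroup (2 ^ i) m ⟩
      2 ^ i * m * 4 ∎))
    where
      open ≡-Reasoning
      quadruple : ∀ u v → (u * u + v * v) * 4 ≡ u * 2 * (u * 2) + v * 2 * (v * 2)
      quadruple = ℕS.solve-∀
      regroup : ∀ p m → 2 * (2 * p) * m ≡ p * m * 4
      regroup = ℕS.solve-∀
      %4≡0 : (x * x + y * y) % 4 ≡ 0
      %4≡0 = trans (cong (_% 4) (trans eq (regroup (2 ^ i) m))) (m*n%n≡0 (2 ^ i * m) 4)
      x-even = proj₁ (sum-of-squares-%4≡0 x y %4≡0)
      y-even = proj₂ (sum-of-squares-%4≡0 x y %4≡0)

module EvenCoefficients where

  open import Defs using (c)
  open ParitySums
  open PowerSeries
  open ThetaSeries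
  open IntegerParity
  open ReciprocalOfΨ
  open ΨAsTheta
  open SumsOfTwoSquares
  open import Data.Parity.Base using (0ℙ; 1ℙ)
  open import Data.Nat
  open import Data.Nat.Properties
  open import Data.Nat.DivMod using (_/_; _%_; m/n*n≡m; [m+kn]%n≡m%n)
  open import Data.Nat.Divisibility using (_∣_; divides; ∣m∣n⇒∣m+n; n∣m*n)
  open import Data.Integer as ℤ using (+_; ∣_∣)
  import Data.Integer.Divisibility as ℤ
  open import Data.Product using (∃-syntax; _,_; proj₁; proj₂)
  open import Relation.Binary.PropositionalEquality
    using (_≡_; _≢_; refl; sym; trans; cong; cong₂; subst; _≗_; module ≡-Reasoning)
  open import Algebra.Properties.CommutativeSemigroup ⊛-commutativeSemigroup using (xy∙z≈zx∙y; x∙yz≈z∙xy)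
  import Data.Nat.Tactic.RingSolver as ℕS

  C[q⁷] : Series
  C[q⁷] = dilate 7 (c-mod2 9 5)

  θ₁⊛dissect₈₁C[q⁷] : θ 1 ⊛ dissect₈₁ C[q⁷] ≗ θ 3 ⊛ (θ 2 ⊛ θ 1)
  θ₁⊛dissect₈₁C[q⁷] = begin
    θ 1 ⊛ dissect₈₁ C[q⁷]
      ≈⟨ dissect₈₁-dilate³-⊛ (θ 1) C[q⁷] ⟨
    dissect₈₁ (dilate 2 (dilate 2 (dilate 2 (θ 1))) ⊛ C[q⁷])
      ≈⟨ dissect₈₁-cong (⊛-congʳ C[q⁷] θ₁⊛θ₁⁷) ⟨
    dissect₈₁ ((θ 1 ⊛ θ₁⁷) ⊛ C[q⁷])
      ≈⟨ dissect₈₁-cong (xy∙z≈zx∙y (θ 1) θ₁⁷ C[q⁷]) ⟩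
    dissect₈₁ ((C[q⁷] ⊛ θ 1) ⊛ θ₁⁷)
      ≈⟨ dissect₈₁-cong (⊛-congʳ θ₁⁷ dilate₇c⊛θ₁≗q) ⟩
    dissect₈₁ (q ⊛ θ₁⁷)
      ≈⟨ dissect-cong 2 0 (dissect-cong 2 0 (dissect₂₁-q⊛ θ₁⁷)) ⟩
    dissect 2 0 (dissect 2 0 (dissect 2 0 θ₁⁷))
      ≈⟨ dissect₂³-θ₁⁷ ⟩
    θ 3 ⊛ (θ 2 ⊛ θ 1) ∎
    where open ≗-Reasoning

  dissect₈₁C[q⁷]≗θ₃⊛θ₂ : dissect₈₁ C[q⁷] ≗ θ 3 ⊛ θ 2
  dissect₈₁C[q⁷]≗θ₃⊛θ₂ = q-cancel (begin
    q ⊛ dissect₈₁ C[q⁷]                ≈⟨ ⊛-congʳ (dissect₈₁ C[q⁷]) dilate₇c⊛θ₁≗q ⟨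
    (C[q⁷] ⊛ θ 1) ⊛ dissect₈₁ C[q⁷]    ≈⟨ ⊛-assoc C[q⁷] (θ 1) (dissect₈₁ C[q⁷]) ⟩
    C[q⁷] ⊛ (θ 1 ⊛ dissect₈₁ C[q⁷])    ≈⟨ ⊛-congˡ C[q⁷] θ₁⊛dissect₈₁C[q⁷] ⟩
    C[q⁷] ⊛ (θ 3 ⊛ (θ 2 ⊛ θ 1))        ≈⟨ ⊛-congˡ C[q⁷] (x∙yz≈z∙xy (θ 3) (θ 2) (θ 1)) ⟩
    C[q⁷] ⊛ (θ 1 ⊛ (θ 3 ⊛ θ 2))        ≈⟨ ⊛-assoc C[q⁷] (θ 1) (θ 3 ⊛ θ 2) ⟨
    (C[q⁷] ⊛ θ 1) ⊛ (θ 3 ⊛ θ 2)        ≈⟨ ⊛-congʳ (θ 3 ⊛ θ 2) dilate₇c⊛θ₁≗q ⟩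
    q ⊛ (θ 3 ⊛ θ 2)                    ∎)
    where open ≗-Reasoning

  c-mod2≡θ₃⊛θ₂ : ∀ {N L} → N * 7 ≡ 1 + L * 8 → c-mod2 9 5 N ≡ (θ 3 ⊛ θ 2) L
  c-mod2≡θ₃⊛θ₂ {N} {L} 7N≡8L+1 = begin
    c-mod2 9 5 N           ≡⟨ dilate-* 7 (c-mod2 9 5) N ⟨
    C[q⁷] (N * 7)          ≡⟨ cong C[q⁷] (trans 7N≡8L+1 (cong suc (octuple L))) ⟩
    dissect₈₁ C[q⁷] L      ≡⟨ dissect₈₁C[q⁷]≗θ₃⊛θ₂ L ⟩
    (θ 3 ⊛ θ 2) L          ∎
    where
      open ≡-Reasoning
      octuple : ∀ L → L * 8 ≡ L * 2 * 2 * 2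
      octuple = ℕS.solve-∀

  c-mod2≡0ℙ : ∀ N i {m} → m % 4 ≡ 3 → N * 7 ≡ 1 + 2 ^ i * m * 8 → c-mod2 9 5 N ≡ 0ℙ
  c-mod2≡0ℙ N i {m} m%4≡3 7N≡8L+1 =
    trans (c-mod2≡θ₃⊛θ₂ {N} {2 ^ i * m} 7N≡8L+1) (≢1ℙ⇒≡0ℙ ((θ 3 ⊛ θ 2) (2 ^ i * m)) no-representation)
    where
      no-representation : (θ 3 ⊛ θ 2) (2 ^ i * m) ≢ 1ℙ
      no-representation ⊛≡1 with θ⊛θ≡1ℙ⇒sum-of-squares 3 2 (2 ^ i * m) ⊛≡1
      ... | x , y , x²+y²≡L = sum-of-squares≢2^i*m i m%4≡3 x y x²+y²≡L

  c-even : ∀ N i {m} → m % 4 ≡ 3 → N * 7 ≡ 1 + 2 ^ i * m * 8 → + 2 ℤ.∣ c 9 5 N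
  c-even N i m%4≡3 7N≡8L+1 = divides k (trans ∣c∣≡k+k (double k))
    where
      halves = parity≡0ℙ⇒even ∣ c 9 5 N ∣ (c-mod2≡0ℙ N i m%4≡3 7N≡8L+1)
      k = proj₁ halves
      ∣c∣≡k+k = proj₂ halves
      double : ∀ k → k + k ≡ k * 2
      double = ℕS.solve-∀

  8^k≡1+7σ : ∀ k → ∃[ σ ] 2 ^ (3 * k) ≡ 1 + σ * 7
  8^k≡1+7σ zero = 0 , refl
  8^k≡1+7σ (suc k) = 1 + σ * 8 , (begin
    2 ^ (3 * suc k)       ≡⟨ cong (2 ^_) (*-suc 3 k) ⟩
    2 ^ (3 + 3 * k)       ≡⟨ ^-distribˡ-+-* 2 3 (3 * k) ⟩
    8 * 2 ^ (3 * k)       ≡⟨ cong (8 *_) (proj₂ (8^k≡1+7σ k)) ⟩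
    8 * (1 + σ * 7)       ≡⟨ regroup σ ⟩
    1 + (1 + σ * 8) * 7   ∎)
    where
      open ≡-Reasoning
      σ = proj₁ (8^k≡1+7σ k)
      regroup : ∀ σ → 8 * (1 + σ * 7) ≡ 1 + (1 + σ * 8) * 7
      regroup = ℕS.solve-∀

  7∣a*2^[3k+j]+1 : ∀ k j a → 7 ∣ a * 2 ^ j + 1 → 7 ∣ a * 2 ^ (3 * k + j) + 1
  7∣a*2^[3k+j]+1 k j a 7∣ = subst (7 ∣_) (sym (begin
    a * 2 ^ (3 * k + j) + 1               ≡⟨ cong (λ p → a * p + 1) (^-distribˡ-+-* 2 (3 * k) j) ⟩
    a * (2 ^ (3 * k) * 2 ^ j) + 1         ≡⟨ cong (λ p → a * (p * 2 ^ j) + 1) (proj₂ (8^k≡1+7σ k)) ⟩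
    a * ((1 + σ * 7) * 2 ^ j) + 1         ≡⟨ regroup a (2 ^ j) σ ⟩
    (a * 2 ^ j + 1) + a * 2 ^ j * σ * 7   ∎)) (∣m∣n⇒∣m+n 7∣ (n∣m*n (a * 2 ^ j * σ)))
    where
      open ≡-Reasoning
      σ = proj₁ (8^k≡1+7σ k)
      regroup : ∀ a p σ → a * ((1 + σ * 7) * p) + 1 ≡ (a * p + 1) + a * p * σ * 7
      regroup = ℕS.solve-∀

  progression-index : ∀ i a n → 7 ∣ a * 2 ^ (i + 3) + 1 →
                      (2 ^ (i + 5) * n + (a * 2 ^ (i + 3) + 1) / 7) * 7 ≡ 1 + 2 ^ i * (28 * n + a) * 8
  progression-index i a n 7∣ = begin
    (2 ^ (i + 5) * n + (a * 2 ^ (i + 3) + 1) / 7) * 7     ≡⟨ *-distribʳ-+ 7 (2 ^ (i + 5) * n) _ ⟩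
    2 ^ (i + 5) * n * 7 + (a * 2 ^ (i + 3) + 1) / 7 * 7   ≡⟨ cong (λ x → 2 ^ (i + 5) * n * 7 + x) (m/n*n≡m 7∣) ⟩
    2 ^ (i + 5) * n * 7 + (a * 2 ^ (i + 3) + 1)           ≡⟨ cong₂ (λ p p′ → p * n * 7 + (a * p′ + 1))
                                                                  (^-distribˡ-+-* 2 i 5) (^-distribˡ-+-* 2 i 3) ⟩
    2 ^ i * 32 * n * 7 + (a * (2 ^ i * 8) + 1)            ≡⟨ regroup (2 ^ i) n a ⟩
    1 + 2 ^ i * (28 * n + a) * 8                          ∎
    where
      open ≡-Reasoning
      regroup : ∀ p n a → p * 32 * n * 7 + (a * (p * 8) + 1) ≡ 1 + p * (28 * n + a) * 8
      regroup = ℕS.solve-∀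

  -- The exponents e₃ = i + 3 and e₅ = i + 5 are parameters so that they only need to be equal to
  -- the theorem's 3k + 4, 3k + 6, … propositionally.
  c-even-progression : ∀ {e₃ e₅} i a n → i + 3 ≡ e₃ → i + 5 ≡ e₅ → a % 4 ≡ 3 → 7 ∣ a * 2 ^ e₃ + 1 →
                       + 2 ℤ.∣ c 9 5 (2 ^ e₅ * n + (a * 2 ^ e₃ + 1) / 7)
  c-even-progression i a n refl refl a%4≡3 7∣ =
    c-even (2 ^ (i + 5) * n + (a * 2 ^ (i + 3) + 1) / 7) i 28n+a%4≡3 (progression-index i a n 7∣)
    where
      reorder : ∀ n a → 28 * n + a ≡ a + 7 * n * 4
      reorder = ℕS.solve-∀
      28n+a%4≡3 : (28 * n + a) % 4 ≡ 3
      28n+a%4≡3 = trans (cong (_% 4) (reorder n a)) (trans ([m+kn]%n≡m%n a (7 * n) 4) a%4≡3)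

open import Defs
open import Data.Nat using (ℕ; _+_; _*_; _^_)
open import Data.Nat.DivMod using (_/_)
open import Data.Integer using (+_)
open import Data.Integer.Divisibility using (_∣_)
open import Data.Product using (_×_; _,_)
open import Data.Nat.Properties using (+-assoc)
open import Data.Nat.Divisibility using (divides)
open import Relation.Binary.PropositionalEquality using (refl)
open EvenCoefficients using (c-even-progression; 7∣a*2^[3k+j]+1)

theorem6p1 : (n k : ℕ) →
    ((+ 2) ∣ c 9 5 (2 ^ (3 * k + 5) * n + (27 * 2 ^ (3 * k + 3) + 1) / 7))
    × ((+ 2) ∣ c 9 5 (2 ^ (3 * k + 6) * n + (3 * 2 ^ (3 * k + 4) + 1) / 7))
    × ((+ 2) ∣ c 9 5 (2 ^ (3 * k + 7) * n + (19 * 2 ^ (3 * k + 5) + 1) / 7))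
theorem6p1 n k =
    c-even-progression (3 * k) 27 n refl refl refl
                       (7∣a*2^[3k+j]+1 k 3 27 (divides 31 refl))
  , c-even-progression (3 * k + 1) 3 n (+-assoc (3 * k) 1 3) (+-assoc (3 * k) 1 5) refl
                       (7∣a*2^[3k+j]+1 k 4 3 (divides 7 refl))
  , c-even-progression (3 * k + 2) 19 n (+-assoc (3 * k) 2 3) (+-assoc (3 * k) 2 5) refl
                       (7∣a*2^[3k+j]+1 k 5 19 (divides 87 refl))
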